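{- Let $n=|Ag|\geq 1$ and $\mathsf{X}\subseteq\{\mathbf{D2},\mathbf{D3},\mathbf{D4},\mathbf{D5}\}$. For any sequent $\Lambda$, either $\Lambda$ is derivable in $\mathsf{G3DS}_{n}\mathsf{X}$, or there exist a $\mathsf{DS}_{n}\mathsf{X}$-model $M$ and a map $I$ from labels to worlds of $M$ such that $M,I\not\models\Lambda$.
   Context: Language $\mathcal{L}_n$: $Ag=\{1,\dots,n\}$, $Atm$ countable set of atoms; formulas (negation normal form) $\phi::=p\mid\neg p\mid\phi\lor\phi\mid\phi\land\phi\mid\Box\phi\mid\Diamond\phi\mid[i]\phi\mid\langle i\rangle\phi\mid\otimes_i\phi\mid\ominus_i\phi$. A $\mathsf{DS}_n$-frame is $\langle W,R_\Box,\{R_{[i]}\}_{i\in Ag},\{R_{\otimes_i}\}_{i\in Ag}\rangle$, $W\neq\emptyset$, with: (C1) $R_\Box$ an equivalence relation; (C2) each $R_{[i]}\subseteq R_\Box$ an equivalence relation; (C3) for all $w$ and $u_1,\dots,u_n\in R_\Box(w)$, $\bigcap_i R_{[i]}(u_i)\neq\emptyset$; (D1) $R_\Box wv$ and $R_{\otimes_i}wu$ imply $R_{\otimes_i}vu$. Optional: (D2) each $w$ has an $R_{\otimes_i}$-successor; (D3) $R_{\otimes_i}\subseteq R_\Box$; (D4) $R_{\otimes_i}wv$, $R_{[i]}vu$ imply $R_{\otimes_i}wu$; (D5) each $w$ has $v$ with $R_{\otimes_i}wv$ and $R_{[i]}(v)\subseteq R_{\otimes_i}(w)$. $\mathsf{DS}_n\mathsf{X}$-frames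 additionally satisfy the properties in $\mathsf{X}$ (for all $i$); models add $V:Atm\to\mathcal{P}(W)$; $\Box,[i],\otimes_i$ are interpreted universally and $\Diamond,\langle i\rangle,\ominus_i$ existentially over $R_\Box,R_{[i]},R_{\otimes_i}$; literals, $\land,\lor$ classically. Sequents $\mathcal{R}\vdash\Gamma$: $\mathcal{R}$ a multiset of relational atoms $R_\Box xy,R_{[i]}xy,R_{\otimes_i}xy$, $\Gamma$ a multiset of labelled formulas $x:\phi$. $M,I\models\mathcal{R}\vdash\Gamma$ iff, whenever all atoms of $\mathcal{R}$ hold under $I$, some $z:\phi\in\Gamma$ has $M,I(z)\Vdash\phi$. Paths: $x\sim^{\mathcal{R}}_i y$ iff $x=y$ or $x,y$ are connected by a chain of $R_{[i]}$-atoms of $\mathcal{R}$ taken in either direction; $x\sim^{\mathcal{R}}_\Diamond y$ likewise with $R_\Box$- or any $R_{[j]}$-atoms. Calculus $\mathsf{G3DS}_n$ (premise(s) $\Rightarrow$ conclusion; fresh = not in conclusion): (id) $\mathcal{R}\vdash x:p,x:\neg p,\Gamma$; ($\lor$) $x:\phi,x:\psi\Rightarrow x:\phi\lor\psi$; ($\land$) two premises $x:\phi$, $x:\psi\Rightarrow x:\phi\land\psi$; ($\Box$) $\mathcal{R},R_\Box xy\vdash y:\phi,\Gamma\Rightarrow\mathcal{R}\vdash x:\Box\phi,\Gamma$, $y$ fresh; ($\Diamond$) $\mathcal{R}\vdash x:\Diamond\phi,y:\phi,\Gamma\Rightarrow\mathcal{R}\vdash x:\Diamond\phi,\Gamma$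 if $x\sim^{\mathcal{R}}_\Diamond y$; ($[i]$) analogous to ($\Box$) with $R_{[i]}$; ($\langle i\rangle$) analogous to ($\Diamond$) with condition $x\sim^{\mathcal{R}}_i y$; ($\otimes_i$) analogous to ($\Box$) with $R_{\otimes_i}$; ($\ominus_i$) $\mathcal{R},R_{\otimes_i}xy\vdash x:\ominus_i\phi,y:\phi,\Gamma\Rightarrow\mathcal{R},R_{\otimes_i}xy\vdash x:\ominus_i\phi,\Gamma$; (IOA) $\mathcal{R},R_{[1]}x_1y,\dots,R_{[n]}x_ny\vdash\Gamma\Rightarrow\mathcal{R}\vdash\Gamma$, $y$ fresh, $x_j\sim^{\mathcal{R}}_\Diamond x_{j+1}$ for all $j$; (D1$_i$) $\mathcal{R},R_{\otimes_i}xz,R_{\otimes_i}yz\vdash\Gamma\Rightarrow\mathcal{R},R_{\otimes_i}xz\vdash\Gamma$ if $x\sim^{\mathcal{R}}_\Diamond y$. Extra rules: (D2$_i$) $\mathcal{R},R_{\otimes_i}xy\vdash\Gamma\Rightarrow\mathcal{R}\vdash\Gamma$, $y$ fresh; (D3$_i$) $\mathcal{R},R_{\otimes_i}xy,R_\Box xy\vdash\Gamma\Rightarrow\mathcal{R},R_{\otimes_i}xy\vdash\Gamma$; (D4$_i$) $\mathcal{R},R_{\otimes_i}xy,R_{\otimes_i}xz\vdash\Gamma\Rightarrow\mathcal{R},R_{\otimes_i}xy\vdash\Gamma$ if $y\sim^{\mathcal{R}}_i z$; (D5$_i$) the system of (D5$^1_i$) $\mathcal{R},R_{\otimes_i}xy\vdash\Gamma\Rightarrow\mathcal{R}\vdash\Gamma$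 ($y$ fresh) and (D5$^2_i$) $\mathcal{R}',R_{\otimes_i}xz\vdash\Gamma'\Rightarrow\mathcal{R}'\vdash\Gamma'$ where $y\sim^{\mathcal{R}'}_i z$ and $R_{\otimes_i}xy$ was introduced by an application of (D5$^1_i$) further down in the derivation. $\mathsf{G3DS}_n\mathsf{X}$ is $\mathsf{G3DS}_n$ plus (D$K_i$) for all $i$ whenever $\mathbf{D}K\in\mathsf{X}$. Derivations are finite trees with (id) leaves. -}

module Defs where

open import Data.Nat using (ℕ; suc)
open import Data.Fin using (Fin; toℕ)
open import Data.Fin.Base using () renaming (Fin to Fin′)
open import Data.Bool using (Bool; T)
open import Data.Product using (Σ; _×_; _,_; ∃)
open import Data.List using (List; []; _∷_; _++_; map)
open import Data.List.Base using (allFin)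
open import Data.List.Membership.Propositional using (_∈_)
open import Data.List.Relation.Unary.All using (All)
open import Data.List.Relation.Unary.Any using (Any)
open import Data.List.Relation.Binary.Permutation.Propositional using (_↭_)
open import Relation.Nullary using (¬_)
open import Relation.Binary.PropositionalEquality using (_≡_)

Atm : Set
Atm = ℕ

Label : Set
Label = ℕ

-- Agents Ag = {1,…,n} represented by Fin n.
-- Formulas of L_n in negation normal form.
data Fm (n : ℕ) : Set where
  atom  : Atm → Fm n
  natom : Atm → Fm n
  _∨′_  : Fm n → Fm n → Fm n
  _∧′_  : Fm n → Fm n → Fm n
  □     : Fm n → Fm n
  ◇     : Fm n → Fm n
  [_]   : Fin n → Fm n → Fm n
  ⟨_⟩   : Fin n → Fm n → Fm n
  ⊗     : Fin n → Fm n → Fm n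
  ⊖     : Fin n → Fm n → Fm n

record Ext : Set where
  field
    d2 d3 d4 d5 : Bool
open Ext public

record Model (n : ℕ) (X : Ext) : Set₁ where
  field
    W     : Set
    inhabited : W
    R□    : W → W → Set
    R[_]  : Fin n → W → W → Set
    R⊗    : Fin n → W → W → Set
    V     : Atm → W → Set
    □-refl  : ∀ w → R□ w w
    □-sym   : ∀ {w v} → R□ w v → R□ v w
    □-trans : ∀ {w v u} → R□ w v → R□ v u → R□ w u
    ag-refl  : ∀ i w → R[ i ] w w
    ag-sym   : ∀ i {w v} → R[ i ] w v → R[ i ] v w
    ag-trans : ∀ i {w v u} → R[ i ] w v → R[ i ] v u → R[ i ] w u
    ag⊆□     : ∀ i {w v} → R[ i ] w v → R□ w v
    C3 : ∀ w (u : Fin n → W) → (∀ i → R□ w (u i)) →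
         Σ W λ v → ∀ i → R[ i ] (u i) v
    D1 : ∀ i {w v u} → R□ w v → R⊗ i w u → R⊗ i v u
    D2 : T (d2 X) → ∀ i w → Σ W λ v → R⊗ i w v
    D3 : T (d3 X) → ∀ i {w v} → R⊗ i w v → R□ w v
    D4 : T (d4 X) → ∀ i {w v u} → R⊗ i w v → R[ i ] v u → R⊗ i w u
    D5 : T (d5 X) → ∀ i w → Σ W λ v → R⊗ i w v × (∀ u → R[ i ] v u → R⊗ i w u)

module _ {n : ℕ} {X : Ext} (M : Model n X) where
  open Model M

  infix 4 _⊩_
  _⊩_ : W → Fm n → Set
  w ⊩ atom p   = V p w
  w ⊩ natom p  = ¬ V p w
  w ⊩ (φ ∨′ ψ) = (w ⊩ φ) Data.Sum.⊎ (w ⊩ ψ)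
    where import Data.Sum
  w ⊩ (φ ∧′ ψ) = (w ⊩ φ) × (w ⊩ ψ)
  w ⊩ □ φ      = ∀ v → R□ w v → v ⊩ φ
  w ⊩ ◇ φ      = Σ W λ v → R□ w v × v ⊩ φ
  w ⊩ [ i ] φ  = ∀ v → R[ i ] w v → v ⊩ φ
  w ⊩ ⟨ i ⟩ φ  = Σ W λ v → R[ i ] w v × v ⊩ φ
  w ⊩ ⊗ i φ    = ∀ v → R⊗ i w v → v ⊩ φ
  w ⊩ ⊖ i φ    = Σ W λ v → R⊗ i w v × v ⊩ φ

-- Sequents (multisets represented as lists, taken up to permutation)

data RAtom (n : ℕ) : Set where
  R□a : Label → Label → RAtom n
  R[]a : Fin n → Label → Label → RAtom n
  R⊗a : Fin n → Label → Label → RAtom n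

LFm : ℕ → Set
LFm n = Label × Fm n

record Sequent (n : ℕ) : Set where
  constructor _⊢_
  field
    rel : List (RAtom n)
    fms : List (LFm n)

module _ {n : ℕ} {X : Ext} (M : Model n X) (I : Label → Model.W M) where
  open Model M

  HoldsR : RAtom n → Set
  HoldsR (R□a x y)    = R□ (I x) (I y)
  HoldsR (R[]a i x y) = R[ i ] (I x) (I y)
  HoldsR (R⊗a i x y)  = R⊗ i (I x) (I y)

  HoldsF : LFm n → Set
  HoldsF (z , φ) = _⊩_ M (I z) φ

  Sat : Sequent n → Set
  Sat (R ⊢ Γ) = All HoldsR R → Any HoldsF Γ

OccR : ∀ {n} → Label → RAtom n → Set
OccR z (R□a x y)    = (z ≡ x) Data.Sum.⊎ (z ≡ y)  where import Data.Sum
OccR z (R[]a _ x y) = (z ≡ x) Data.Sum.⊎ (z ≡ y)  where import Data.Sum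
OccR z (R⊗a _ x y)  = (z ≡ x) Data.Sum.⊎ (z ≡ y)  where import Data.Sum

OccF : ∀ {n} → Label → LFm n → Set
OccF z (x , _) = z ≡ x

Fresh : ∀ {n} → Label → List (RAtom n) → List (LFm n) → Set
Fresh y R Γ = ¬ Any (OccR y) R × ¬ Any (OccF y) Γ

data Path[_] {n : ℕ} (i : Fin n) (R : List (RAtom n)) : Label → Label → Set where
  here : ∀ {x} → Path[ i ] R x x
  fwd  : ∀ {x z y} → R[]a i x z ∈ R → Path[ i ] R z y → Path[ i ] R x y
  bwd  : ∀ {x z y} → R[]a i z x ∈ R → Path[ i ] R z y → Path[ i ] R x y

data Path◇ {n : ℕ} (R : List (RAtom n)) : Label → Label → Set where
  here   : ∀ {x} → Path◇ R x x
  fwd□   : ∀ {x z y} → R□a x z ∈ R → Path◇ R z y → Path◇ R x y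
  bwd□   : ∀ {x z y} → R□a z x ∈ R → Path◇ R z y → Path◇ R x y
  fwd[]  : ∀ {j x z y} → R[]a j x z ∈ R → Path◇ R z y → Path◇ R x y
  bwd[]  : ∀ {j x z y} → R[]a j z x ∈ R → Path◇ R z y → Path◇ R x y

-- Der X D R Γ : the sequent R ⊢ Γ is derivable, where D records the
-- relational atoms R⊗a i x y introduced by (D5¹) further down in the
-- derivation (i.e. on the branch between this sequent and the root).

D5Hist : ℕ → Set
D5Hist n = List (Fin n × Label × Label)

data Der {n : ℕ} (X : Ext) (D : D5Hist n) : List (RAtom n) → List (LFm n) → Set where
  perm : ∀ {R R′ Γ Γ′} → R ↭ R′ → Γ ↭ Γ′ → Der X D R Γ → Der X D R′ Γ′
  id   : ∀ {R Γ x p} → Der X D R ((x , atom p) ∷ (x , natom p) ∷ Γ)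
  ∨r   : ∀ {R Γ x φ ψ} → Der X D R ((x , φ) ∷ (x , ψ) ∷ Γ) → Der X D R ((x , φ ∨′ ψ) ∷ Γ)
  ∧r   : ∀ {R Γ x φ ψ} → Der X D R ((x , φ) ∷ Γ) → Der X D R ((x , ψ) ∷ Γ) →
         Der X D R ((x , φ ∧′ ψ) ∷ Γ)
  □r   : ∀ {R Γ x y φ} → Fresh y R ((x , □ φ) ∷ Γ) →
         Der X D (R□a x y ∷ R) ((y , φ) ∷ Γ) → Der X D R ((x , □ φ) ∷ Γ)
  ◇r   : ∀ {R Γ x y φ} → Path◇ R x y →
         Der X D R ((x , ◇ φ) ∷ (y , φ) ∷ Γ) → Der X D R ((x , ◇ φ) ∷ Γ)
  []r  : ∀ {R Γ i x y φ} → Fresh y R ((x , [ i ] φ) ∷ Γ) →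
         Der X D (R[]a i x y ∷ R) ((y , φ) ∷ Γ) → Der X D R ((x , [ i ] φ) ∷ Γ)
  ⟨⟩r  : ∀ {R Γ i x y φ} → Path[ i ] R x y →
         Der X D R ((x , ⟨ i ⟩ φ) ∷ (y , φ) ∷ Γ) → Der X D R ((x , ⟨ i ⟩ φ) ∷ Γ)
  ⊗r   : ∀ {R Γ i x y φ} → Fresh y R ((x , ⊗ i φ) ∷ Γ) →
         Der X D (R⊗a i x y ∷ R) ((y , φ) ∷ Γ) → Der X D R ((x , ⊗ i φ) ∷ Γ)
  ⊖r   : ∀ {R Γ i x y φ} →
         Der X D (R⊗a i x y ∷ R) ((x , ⊖ i φ) ∷ (y , φ) ∷ Γ) →
         Der X D (R⊗a i x y ∷ R) ((x , ⊖ i φ) ∷ Γ)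
  IOA  : ∀ {R Γ} (xs : Fin n → Label) (y : Label) → Fresh y R Γ →
         (∀ (j k : Fin n) → toℕ k ≡ suc (toℕ j) → Path◇ R (xs j) (xs k)) →
         Der X D (R ++ map (λ j → R[]a j (xs j) y) (allFin n)) Γ → Der X D R Γ
  D1r  : ∀ {R Γ i x y z} → Path◇ R x y →
         Der X D (R⊗a i x z ∷ R⊗a i y z ∷ R) Γ → Der X D (R⊗a i x z ∷ R) Γ
  D2r  : ∀ {R Γ i x y} → T (d2 X) → Fresh y R Γ →
         Der X D (R⊗a i x y ∷ R) Γ → Der X D R Γ
  D3r  : ∀ {R Γ i x y} → T (d3 X) →
         Der X D (R⊗a i x y ∷ R□a x y ∷ R) Γ → Der X D (R⊗a i x y ∷ R) Γ
  D4r  : ∀ {R Γ i x y z} → T (d4 X) → Path[ i ] R y z →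
         Der X D (R⊗a i x y ∷ R⊗a i x z ∷ R) Γ → Der X D (R⊗a i x y ∷ R) Γ
  D5¹r : ∀ {R Γ i x y} → T (d5 X) → Fresh y R Γ →
         Der X ((i , x , y) ∷ D) (R⊗a i x y ∷ R) Γ → Der X D R Γ
  D5²r : ∀ {R Γ i x y z} → T (d5 X) → (i , x , y) ∈ D → Path[ i ] R y z →
         Der X D (R⊗a i x z ∷ R) Γ → Der X D R Γ

Derivable : ∀ {n} → Ext → Sequent n → Set
Derivable X (R ⊢ Γ) = Der X [] R Γ

{-# OPTIONS --safe #-}

-- Search for a derivation of Λ backwards and fairly: a fixed schedule lists every
-- rule instance (principal formula or atom by its position, path side conditions
-- as routes through the relational atoms) infinitely often, and stage k applies
-- the scheduled instance to the current sequent; only (∧) branches.  If Λ is not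
-- derivable, the leftmost open branch is infinite.  Its labels, related whenever
-- some sequent on the branch connects them by a path or contains the atom, form a
-- DS_n X-model: each frame condition is enforced by the corresponding rule, which
-- fairness eventually applies.  By induction on formulas, no formula occurring on
-- the branch holds at its label, so the root sequent is falsified.
--
-- Constructively the branch is only ever available through finite prefixes, so
-- "eventually on the branch" is stated under a double negation; this is enough
-- because the theorem is itself double-negated.  Labels created by the search are
-- determined by what they witness, so the model can name its witnesses outside
-- the double negation.

module Submission where

open import Defs
open import Data.Bool using (Bool; true; false; T)
open import Data.Bool.Properties using (T?)
open import Data.Empty using (⊥; ⊥-elim)
open import Data.Fin using (Fin; toℕ) renaming (zero to fzero; suc to fsuc; _≟_ to _≟ᶠ_)
open import Data.Fin.Properties using (all?)
open import Data.List using (List; []; _∷_; _++_; _∷ʳ_; length; reverse; map; foldr; allFin)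
open import Data.List.Properties using (unfold-reverse; ++-identityʳ; ++-assoc)
open import Data.List.Membership.Propositional using (_∈_; lose; find)
open import Data.List.Membership.Propositional.Properties using (∈-map⁺; ∈-allFin)
import Data.List.Relation.Unary.All as All
open import Data.List.Relation.Unary.Any using (Any; here; there; any?; satisfied)
open import Data.List.Relation.Unary.Any.Properties using (++⁺ˡ; ++⁺ʳ; ++⁻; map⁻)
open import Data.List.Relation.Binary.Permutation.Propositional using (_↭_; ↭-refl; ↭-sym; ↭-trans; prep; swap)
open import Data.List.Relation.Binary.Permutation.Propositional.Properties using (∷↭∷ʳ; Any-resp-↭; ∈-resp-↭)
open import Data.Maybe using (Maybe; just; nothing) renaming (_>>=_ to _>>=ᵐ_; map to mapᵐ)
open import Data.Maybe.Properties using () renaming (≡-dec to ≡-decᵐ)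
open import Data.Nat using (ℕ; zero; suc; _+_; _⊔_; _≤_; _<_; z≤n; s≤s; _<?_; _≟_)
open import Data.Nat.Properties
  using (≤-refl; ≤-trans; ≤-total; <-irrefl; ≤-<-trans; <-≤-trans; m≤n⇒m<n∨m≡n; n≤1+n; m≤n⇒m≤1+n;
         +-suc; +-identityʳ; suc-injective; m≤m⊔n; m≤n⊔m; m≤m+n; +-cancelˡ-≡)
open import Data.Product using (Σ; ∃-syntax; _×_; _,_; proj₁; proj₂)
open import Data.Product.Properties using (≡-dec)
open import Data.Sum using (_⊎_; inj₁; inj₂; [_,_]′; map₁)
open import Data.Unit using (⊤; tt)
open import Data.Vec using (Vec; lookup; tabulate; toList; fromList) renaming ([] to []ᵛ; _∷_ to _∷ᵛ_)
open import Data.Vec.Properties using (toList∘fromList; lookup∘tabulate)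
open import Effect.Monad using (RawMonad)
open import Function using (_∘_)
open import Level using (0ℓ)
open import Relation.Binary.PropositionalEquality using (_≡_; _≢_; refl; sym; trans; cong; subst; subst₂)
open import Relation.Nullary using (¬_; Dec; yes; no)
open import Relation.Nullary.Decidable using (_×-dec_; _⊎-dec_; ¬?; ¬¬-excluded-middle)
open import Relation.Nullary.Negation using (¬¬-Monad)

module Enumeration where

  -- Cantor's enumeration of ℕ × ℕ, one antidiagonal a + b = s after another.
  unpair : ℕ → ℕ × ℕ
  unpair zero = 0 , 0
  unpair (suc k) with unpair k
  ... | a , zero  = 0 , suc a
  ... | a , suc b = suc a , b

  private
    unpair-next-diagonal : ∀ k {a} → unpair k ≡ (a , 0) → unpair (suc k) ≡ (0 , suc a)
    unpair-next-diagonal k e rewrite e = refl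

    unpair-along-diagonal : ∀ k {a b} → unpair k ≡ (a , suc b) → unpair (suc k) ≡ (suc a , b)
    unpair-along-diagonal k e rewrite e = refl

    unpair-onto-diagonal : ∀ s a b → a + b ≡ s → ∃[ k ] unpair k ≡ (a , b)
    unpair-onto-diagonal zero    zero    zero    _  = 0 , refl
    unpair-onto-diagonal (suc s) zero    (suc b) eq =
      let k , e = unpair-onto-diagonal s b zero (trans (+-identityʳ b) (suc-injective eq))
      in suc k , unpair-next-diagonal k e
    unpair-onto-diagonal s       (suc a) b       eq =
      let k , e = unpair-onto-diagonal s a (suc b) (trans (+-suc a b) eq)
      in suc k , unpair-along-diagonal k e

  unpair-surjective : ∀ a b → ∃[ k ] unpair k ≡ (a , b)
  unpair-surjective a b = unpair-onto-diagonal (a + b) a b refl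

  unpair-≤ : ∀ k → proj₁ (unpair k) ≤ k × proj₂ (unpair k) ≤ k
  unpair-≤ zero = z≤n , z≤n
  unpair-≤ (suc k) with unpair k | unpair-≤ k
  ... | a , zero  | a≤k , _   = z≤n , s≤s a≤k
  ... | a , suc b | a≤k , b<k = s≤s a≤k , ≤-trans (n≤1+n b) (m≤n⇒m≤1+n b<k)

  record Enumeration (A : Set) : Set where
    field
      enum            : ℕ → A
      enum-surjective : ∀ a → ∃[ k ] enum k ≡ a
  open Enumeration public

  index : ∀ {A} → Enumeration A → A → ℕ
  index E a = proj₁ (enum-surjective E a)

  index-injective : ∀ {A} (E : Enumeration A) {a b} → index E a ≡ index E b → a ≡ b
  index-injective E {a} {b} e =
    trans (sym (proj₂ (enum-surjective E a))) (trans (cong (enum E) e) (proj₂ (enum-surjective E b)))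

  retract : ∀ {A B} → Enumeration A → (f : A → B) (g : B → A) → (∀ b → f (g b) ≡ b) → Enumeration B
  retract E f g fg = record
    { enum            = λ k → f (enum E k)
    ; enum-surjective = λ b → let k , e = enum-surjective E (g b) in k , trans (cong f e) (fg b)
    }

  ℕ-enum : Enumeration ℕ
  ℕ-enum = record { enum = λ k → k ; enum-surjective = λ a → a , refl }

  -- Out-of-range indices are sent to the last element.
  clamp : ∀ m → ℕ → Fin (suc m)
  clamp m       zero    = fzero
  clamp zero    (suc k) = fzero
  clamp (suc m) (suc k) = fsuc (clamp m k)

  clamp-toℕ : ∀ m (i : Fin (suc m)) → clamp m (toℕ i) ≡ i
  clamp-toℕ m       fzero    = refl
  clamp-toℕ (suc m) (fsuc i) = cong fsuc (clamp-toℕ m i)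

  Fin-enum : ∀ m → Enumeration (Fin (suc m))
  Fin-enum m = record { enum = clamp m ; enum-surjective = λ i → toℕ i , clamp-toℕ m i }

  ×-enum : ∀ {A B} → Enumeration A → Enumeration B → Enumeration (A × B)
  ×-enum EA EB = record { enum = pairUp ; enum-surjective = onto }
    where
    pairUp : ℕ → _
    pairUp k = enum EA (proj₁ (unpair k)) , enum EB (proj₂ (unpair k))
    onto : ∀ p → ∃[ k ] pairUp k ≡ p
    onto (a , b) with enum-surjective EA a | enum-surjective EB b
    ... | i , refl | j , refl with unpair-surjective i j
    ... | k , e = k , cong (λ (i , j) → enum EA i , enum EB j) e

  ⊎-enum : ∀ {A B} → Enumeration A → Enumeration B → Enumeration (A ⊎ B)
  ⊎-enum {A} {B} EA EB = retract (×-enum ℕ-enum (×-enum EA EB)) choose split choose-split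
    where
    choose : ℕ × A × B → A ⊎ B
    choose (zero  , a , _) = inj₁ a
    choose (suc _ , _ , b) = inj₂ b
    split : A ⊎ B → ℕ × A × B
    split (inj₁ a) = 0 , a , enum EB 0
    split (inj₂ b) = 1 , enum EA 0 , b
    choose-split : ∀ s → choose (split s) ≡ s
    choose-split (inj₁ a) = refl
    choose-split (inj₂ b) = refl

  Vec-enum : ∀ {A} → Enumeration A → ∀ n → Enumeration (Vec A n)
  Vec-enum E zero    = record { enum = λ _ → []ᵛ ; enum-surjective = λ { []ᵛ → 0 , refl } }
  Vec-enum E (suc n) = retract (×-enum E (Vec-enum E n))
    (λ (x , xs) → x ∷ᵛ xs) (λ { (x ∷ᵛ xs) → x , xs }) (λ { (x ∷ᵛ xs) → refl })

  List-enum : ∀ {A} → Enumeration A → Enumeration (List A)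
  List-enum {A} E = record { enum = byLength ; enum-surjective = onto }
    where
    byLength : ℕ → List A
    byLength k = toList (enum (Vec-enum E (proj₁ (unpair k))) (proj₂ (unpair k)))
    onto : ∀ xs → ∃[ k ] byLength k ≡ xs
    onto xs with enum-surjective (Vec-enum E (length xs)) (fromList xs)
    ... | i , ei with unpair-surjective (length xs) i
    ... | k , ek = k , trans (cong (λ (l , i) → toList (enum (Vec-enum E l) i)) ek)
                             (trans (cong toList ei) (toList∘fromList xs))

  recurrent : ∀ {A} → Enumeration A → ℕ → A
  recurrent E k = enum E (proj₁ (unpair k))

  recurrent-after : ∀ {A} (E : Enumeration A) a m → ∃[ k ] m ≤ k × recurrent E k ≡ a
  recurrent-after E a m with enum-surjective E a
  ... | c , ec with unpair-surjective c m
  ... | k , ek = k , subst (λ p → proj₂ p ≤ k) ek (proj₂ (unpair-≤ k))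
                   , trans (cong (λ p → enum E (proj₁ p)) ek) ec

open Enumeration

module _ {A : Set} where

  _!!_ : List A → ℕ → Maybe A
  []       !! _     = nothing
  (x ∷ xs) !! zero  = just x
  (x ∷ xs) !! suc k = xs !! k

  _[_]≔_ : List A → ℕ → A → List A
  []       [ _     ]≔ _ = []
  (x ∷ xs) [ zero  ]≔ y = y ∷ xs
  (x ∷ xs) [ suc k ]≔ y = x ∷ (xs [ k ]≔ y)

  remove : List A → ℕ → List A
  remove []       _       = []
  remove (x ∷ xs) zero    = xs
  remove (x ∷ xs) (suc k) = x ∷ remove xs k

  !!⇒∈ : ∀ (xs : List A) {k x} → xs !! k ≡ just x → x ∈ xs
  !!⇒∈ (y ∷ xs) {zero}  refl = here refl
  !!⇒∈ (y ∷ xs) {suc k} e    = there (!!⇒∈ xs e)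

  ∈⇒!! : ∀ {xs : List A} {x} → x ∈ xs → ∃[ k ] xs !! k ≡ just x
  ∈⇒!! (here refl) = zero , refl
  ∈⇒!! (there p)   = let k , e = ∈⇒!! p in suc k , e

  !!-++ : ∀ (xs : List A) {ys k x} → xs !! k ≡ just x → (xs ++ ys) !! k ≡ just x
  !!-++ (y ∷ xs) {k = zero}  e = e
  !!-++ (y ∷ xs) {k = suc k} e = !!-++ xs e

  !!-∷ʳ : ∀ (xs : List A) {y} → (xs ∷ʳ y) !! length xs ≡ just y
  !!-∷ʳ []       = refl
  !!-∷ʳ (x ∷ xs) = !!-∷ʳ xs

  remove-↭ : ∀ (xs : List A) {k x} → xs !! k ≡ just x → xs ↭ x ∷ remove xs k
  remove-↭ (y ∷ xs) {zero}  refl = ↭-refl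
  remove-↭ (y ∷ xs) {suc k} e    = ↭-trans (prep y (remove-↭ xs e)) (swap y _ ↭-refl)

  ≔-↭ : ∀ (xs : List A) {k x} y → xs !! k ≡ just x → xs [ k ]≔ y ↭ y ∷ remove xs k
  ≔-↭ (z ∷ xs) {zero}  y refl = ↭-refl
  ≔-↭ (z ∷ xs) {suc k} y e    = ↭-trans (prep z (≔-↭ xs y e)) (swap z y ↭-refl)

  ≔-!!-same : ∀ (xs : List A) {k x} y → xs !! k ≡ just x → (xs [ k ]≔ y) !! k ≡ just y
  ≔-!!-same (z ∷ xs) {zero}  y e = refl
  ≔-!!-same (z ∷ xs) {suc k} y e = ≔-!!-same xs y e

  ≔-!!-other : ∀ (xs : List A) k q y → k ≢ q → (xs [ k ]≔ y) !! q ≡ xs !! q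
  ≔-!!-other []       k       q       y _  = refl
  ≔-!!-other (z ∷ xs) zero    zero    y ne = ⊥-elim (ne refl)
  ≔-!!-other (z ∷ xs) zero    (suc q) y _  = refl
  ≔-!!-other (z ∷ xs) (suc k) zero    y _  = refl
  ≔-!!-other (z ∷ xs) (suc k) (suc q) y ne = ≔-!!-other xs k q y (λ e → ne (cong suc e))

  ≔-length : ∀ (xs : List A) k y → length (xs [ k ]≔ y) ≡ length xs
  ≔-length []       k       y = refl
  ≔-length (z ∷ xs) zero    y = refl
  ≔-length (z ∷ xs) (suc k) y = cong suc (≔-length xs k y)

  Any-≔ : ∀ {P : A → Set} (xs : List A) k y → Any P (xs [ k ]≔ y) → Any P xs ⊎ P y
  Any-≔ (z ∷ xs) zero    y (here p)  = inj₂ p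
  Any-≔ (z ∷ xs) zero    y (there p) = inj₁ (there p)
  Any-≔ (z ∷ xs) (suc k) y (here p)  = inj₁ (here p)
  Any-≔ (z ∷ xs) (suc k) y (there p) = map₁ there (Any-≔ xs k y p)

  Any-∷ʳ : ∀ {P : A → Set} xs {y} → Any P (xs ∷ʳ y) → Any P xs ⊎ P y
  Any-∷ʳ xs p with ++⁻ xs p
  ... | inj₁ q        = inj₁ q
  ... | inj₂ (here q) = inj₂ q

  ∷ʳ-↭ : ∀ (xs : List A) x → xs ∷ʳ x ↭ x ∷ xs
  ∷ʳ-↭ xs x = ↭-sym (∷↭∷ʳ x xs)

  ∷ʳ-↭-remove : ∀ (xs : List A) {j a} b → xs !! j ≡ just a → xs ∷ʳ b ↭ a ∷ b ∷ remove xs j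
  ∷ʳ-↭-remove xs b e = ↭-trans (∷ʳ-↭ xs b) (↭-trans (prep b (remove-↭ xs e)) (swap b _ ↭-refl))

  ≔∷ʳ-↭ : ∀ (xs : List A) {q a} b c → xs !! q ≡ just a → (xs [ q ]≔ b) ∷ʳ c ↭ b ∷ c ∷ remove xs q
  ≔∷ʳ-↭ xs b c e = ↭-trans (∷ʳ-↭ _ c) (↭-trans (prep c (≔-↭ xs b e)) (swap c b ↭-refl))

  ∈-remove : ∀ (xs : List A) {j a r} → xs !! j ≡ just a → r ∈ xs → r ≢ a → r ∈ remove xs j
  ∈-remove xs e r∈xs r≢a with ∈-resp-↭ (remove-↭ xs e) r∈xs
  ... | here r≡a = ⊥-elim (r≢a r≡a)
  ... | there p  = p

>>=ᵐ-just : ∀ {A B : Set} (m : Maybe A) (f : A → Maybe B) {b} →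
            (m >>=ᵐ f) ≡ just b → ∃[ a ] m ≡ just a × f a ≡ just b
>>=ᵐ-just (just a) f e = a , refl , e

-- A route is a list of positions in R; walking it from c crosses the atoms at
-- those positions in either direction.  Routes make the path side conditions
-- of the calculus enumerable.
module Routes {n : ℕ} where

  across : Label → Label → Label → Maybe Label
  across u v c with u ≟ c
  ... | yes _ = just v
  ... | no _ with v ≟ c
  ... | yes _ = just u
  ... | no _  = nothing

  across-just : ∀ u v c {d} → across u v c ≡ just d → (u ≡ c × v ≡ d) ⊎ (v ≡ c × u ≡ d)
  across-just u v c e with u ≟ c
  across-just u v c refl | yes p = inj₁ (p , refl)
  ... | no _ with v ≟ c
  across-just u v c refl | no _ | yes q = inj₂ (q , refl)

  across-fwd : ∀ c d → across c d c ≡ just d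
  across-fwd c d with c ≟ c
  ... | yes _ = refl
  ... | no ne = ⊥-elim (ne refl)

  across-bwd : ∀ c d → across d c c ≡ just d
  across-bwd c d with d ≟ c
  ... | yes p = cong just (sym p)
  ... | no _ with c ≟ c
  ... | yes _ = refl
  ... | no ne = ⊥-elim (ne refl)

  across-back : ∀ u v c {d} → across u v c ≡ just d → across u v d ≡ just c
  across-back u v c e with across-just u v c e
  ... | inj₁ (refl , refl) = across-bwd v u
  ... | inj₂ (refl , refl) = across-fwd u v

  Step : Set
  Step = RAtom n → Label → Maybe Label

  step◇ : Step
  step◇ (R□a u v)    c = across u v c
  step◇ (R[]a _ u v) c = across u v c
  step◇ (R⊗a _ _ _)  c = nothing

  step[_] : Fin n → Step
  step[ i ] (R□a u v)    c = nothing
  step[ i ] (R[]a j u v) c with i ≟ᶠ j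
  ... | yes _ = across u v c
  ... | no _  = nothing
  step[ i ] (R⊗a _ _ _)  c = nothing

  Reversible : Step → Set
  Reversible step = ∀ r c {d} → step r c ≡ just d → step r d ≡ just c

  step◇-reversible : Reversible step◇
  step◇-reversible (R□a u v)    c e = across-back u v c e
  step◇-reversible (R[]a _ u v) c e = across-back u v c e

  step[]-reversible : ∀ i → Reversible step[ i ]
  step[]-reversible i (R[]a j u v) c e with i ≟ᶠ j
  ... | yes _ = across-back u v c e

  step[]⇒step◇ : ∀ i r c {d} → step[ i ] r c ≡ just d → step◇ r c ≡ just d
  step[]⇒step◇ i (R[]a j u v) c e with i ≟ᶠ j
  ... | yes _ = e

  walk : Step → List (RAtom n) → Label → List ℕ → Maybe Label
  walk step R c []       = just c
  walk step R c (k ∷ ks) = (R !! k >>=ᵐ λ r → step r c) >>=ᵐ λ d → walk step R d ks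

  walk◇ : List (RAtom n) → Label → List ℕ → Maybe Label
  walk◇ = walk step◇

  walk[_] : Fin n → List (RAtom n) → Label → List ℕ → Maybe Label
  walk[ i ] = walk step[ i ]

  walk-∷⁻ : ∀ step R c k ks {y} → walk step R c (k ∷ ks) ≡ just y →
            ∃[ r ] ∃[ d ] R !! k ≡ just r × step r c ≡ just d × walk step R d ks ≡ just y
  walk-∷⁻ step R c k ks e with >>=ᵐ-just (R !! k >>=ᵐ λ r → step r c) _ e
  ... | d , e₁ , e₂ with >>=ᵐ-just (R !! k) (λ r → step r c) e₁
  ... | r , e₃ , e₄ = r , d , e₃ , e₄ , e₂

  walk-∷⁺ : ∀ step R c k ks {r d y} → R !! k ≡ just r → step r c ≡ just d →
            walk step R d ks ≡ just y → walk step R c (k ∷ ks) ≡ just y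
  walk-∷⁺ step R c k ks e₁ e₂ e₃ rewrite e₁ | e₂ = e₃

  walk-edge : ∀ step R k {r c d} → R !! k ≡ just r → step r c ≡ just d → walk step R c (k ∷ []) ≡ just d
  walk-edge step R k {c = c} e₁ e₂ = walk-∷⁺ step R c k [] e₁ e₂ refl

  walk-extend : ∀ step R E c ps {y} → walk step R c ps ≡ just y → walk step (R ++ E) c ps ≡ just y
  walk-extend step R E c []       e = e
  walk-extend step R E c (k ∷ ks) e with walk-∷⁻ step R c k ks e
  ... | r , d , e₁ , e₂ , e₃ = walk-∷⁺ step (R ++ E) c k ks (!!-++ R e₁) e₂ (walk-extend step R E d ks e₃)

  walk-++ : ∀ step R c ps qs {y z} → walk step R c ps ≡ just y → walk step R y qs ≡ just z →
            walk step R c (ps ++ qs) ≡ just z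
  walk-++ step R c []       qs refl e′ = e′
  walk-++ step R c (k ∷ ks) qs e    e′ with walk-∷⁻ step R c k ks e
  ... | r , d , e₁ , e₂ , e₃ = walk-∷⁺ step R c k (ks ++ qs) e₁ e₂ (walk-++ step R d ks qs e₃ e′)

  walk-reverse : ∀ step → Reversible step → ∀ R c ps {y} →
                 walk step R c ps ≡ just y → walk step R y (reverse ps) ≡ just c
  walk-reverse step rev R c []       refl = refl
  walk-reverse step rev R c (k ∷ ks) e with walk-∷⁻ step R c k ks e
  ... | r , d , e₁ , e₂ , e₃ rewrite unfold-reverse k ks =
    walk-++ step R _ (reverse ks) (k ∷ []) (walk-reverse step rev R d ks e₃) (walk-edge step R k e₁ (rev r c e₂))

  walk◇-reverse : ∀ R c ps {y} → walk◇ R c ps ≡ just y → walk◇ R y (reverse ps) ≡ just c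
  walk◇-reverse = walk-reverse step◇ step◇-reversible

  walk[]-reverse : ∀ i R c ps {y} → walk[ i ] R c ps ≡ just y → walk[ i ] R y (reverse ps) ≡ just c
  walk[]-reverse i = walk-reverse step[ i ] (step[]-reversible i)

  walk[]⇒walk◇ : ∀ i R c ps {y} → walk[ i ] R c ps ≡ just y → walk◇ R c ps ≡ just y
  walk[]⇒walk◇ i R c []       e = e
  walk[]⇒walk◇ i R c (k ∷ ks) e with walk-∷⁻ step[ i ] R c k ks e
  ... | r , d , e₁ , e₂ , e₃ = walk-∷⁺ step◇ R c k ks e₁ (step[]⇒step◇ i r c e₂) (walk[]⇒walk◇ i R d ks e₃)

  walk◇-□edge : ∀ R k {x y} → R !! k ≡ just (R□a x y) → walk◇ R x (k ∷ []) ≡ just y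
  walk◇-□edge R k {x} {y} e = walk-edge step◇ R k e (across-fwd x y)

  walk[]-edge : ∀ R k i {x y} → R !! k ≡ just (R[]a i x y) → walk[ i ] R x (k ∷ []) ≡ just y
  walk[]-edge R k i {x} {y} e = walk-edge step[ i ] R k e step-i
    where
    step-i : step[ i ] (R[]a i x y) x ≡ just y
    step-i with i ≟ᶠ i
    ... | yes _ = across-fwd x y
    ... | no ne = ⊥-elim (ne refl)

  walk◇⇒Path◇ : ∀ R c ps {y} → walk◇ R c ps ≡ just y → Path◇ R c y
  walk◇⇒Path◇ R c []       refl = here
  walk◇⇒Path◇ R c (k ∷ ks) e with walk-∷⁻ step◇ R c k ks e
  ... | R□a u v , d , e₁ , e₂ , e₃ with across-just u v c e₂
  ... | inj₁ (refl , refl) = fwd□ (!!⇒∈ R e₁) (walk◇⇒Path◇ R d ks e₃)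
  ... | inj₂ (refl , refl) = bwd□ (!!⇒∈ R e₁) (walk◇⇒Path◇ R d ks e₃)
  walk◇⇒Path◇ R c (k ∷ ks) e | R[]a j u v , d , e₁ , e₂ , e₃ with across-just u v c e₂
  ... | inj₁ (refl , refl) = fwd[] (!!⇒∈ R e₁) (walk◇⇒Path◇ R d ks e₃)
  ... | inj₂ (refl , refl) = bwd[] (!!⇒∈ R e₁) (walk◇⇒Path◇ R d ks e₃)

  walk[]⇒Path[] : ∀ i R c ps {y} → walk[ i ] R c ps ≡ just y → Path[ i ] R c y
  walk[]⇒Path[] i R c []       refl = here
  walk[]⇒Path[] i R c (k ∷ ks) e with walk-∷⁻ step[ i ] R c k ks e
  ... | R[]a j u v , d , e₁ , e₂ , e₃ with i ≟ᶠ j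
  ... | yes refl with across-just u v c e₂
  ... | inj₁ (refl , refl) = fwd (!!⇒∈ R e₁) (walk[]⇒Path[] i R d ks e₃)
  ... | inj₂ (refl , refl) = bwd (!!⇒∈ R e₁) (walk[]⇒Path[] i R d ks e₃)

  step◇-occurs : ∀ r c {d} → step◇ r c ≡ just d → OccR d r
  step◇-occurs (R□a u v)    c e with across-just u v c e
  ... | inj₁ (_ , refl) = inj₂ refl
  ... | inj₂ (_ , refl) = inj₁ refl
  step◇-occurs (R[]a _ u v) c e with across-just u v c e
  ... | inj₁ (_ , refl) = inj₂ refl
  ... | inj₂ (_ , refl) = inj₁ refl

  walk◇-end : ∀ R c ps {y} → walk◇ R c ps ≡ just y → y ≡ c ⊎ Any (OccR y) R
  walk◇-end R c []       refl = inj₁ refl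
  walk◇-end R c (k ∷ ks) e with walk-∷⁻ step◇ R c k ks e
  ... | r , d , e₁ , e₂ , e₃ with walk◇-end R d ks e₃
  ... | inj₂ p    = inj₂ p
  ... | inj₁ refl = inj₂ (lose (!!⇒∈ R e₁) (step◇-occurs r c e₂))

  Path◇-mono : ∀ {R R′ : List (RAtom n)} {x y} → (∀ {u v} → R□a u v ∈ R → R□a u v ∈ R′) →
               (∀ {j u v} → R[]a j u v ∈ R → R[]a j u v ∈ R′) → Path◇ R x y → Path◇ R′ x y
  Path◇-mono f g here        = here
  Path◇-mono f g (fwd□ m p)  = fwd□ (f m) (Path◇-mono f g p)
  Path◇-mono f g (bwd□ m p)  = bwd□ (f m) (Path◇-mono f g p)
  Path◇-mono f g (fwd[] m p) = fwd[] (g m) (Path◇-mono f g p)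
  Path◇-mono f g (bwd[] m p) = bwd[] (g m) (Path◇-mono f g p)

  Path[]-mono : ∀ {i} {R R′ : List (RAtom n)} {x y} → (∀ {u v} → R[]a i u v ∈ R → R[]a i u v ∈ R′) →
                Path[ i ] R x y → Path[ i ] R′ x y
  Path[]-mono g here      = here
  Path[]-mono g (fwd m p) = fwd (g m) (Path[]-mono g p)
  Path[]-mono g (bwd m p) = bwd (g m) (Path[]-mono g p)

module ProofSearch (m : ℕ) (X : Ext) (R₀ : List (RAtom (suc m))) (Γ₀ : List (LFm (suc m))) where

  open Routes

  n : ℕ
  n = suc m

  maxLabelᴬ : RAtom n → ℕ
  maxLabelᴬ (R□a x y)    = x ⊔ y
  maxLabelᴬ (R[]a _ x y) = x ⊔ y
  maxLabelᴬ (R⊗a _ x y)  = x ⊔ y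

  maxLabelᴿ : List (RAtom n) → ℕ
  maxLabelᴿ = foldr (λ r b → maxLabelᴬ r ⊔ b) 0

  maxLabelᴳ : List (LFm n) → ℕ
  maxLabelᴳ = foldr (λ f b → proj₁ f ⊔ b) 0

  -- Labels below B are those that may occur in the root sequent; all labels
  -- created by the search are B + (an index of their tag).
  B : ℕ
  B = suc (maxLabelᴿ R₀ ⊔ maxLabelᴳ Γ₀)

  ≤-⊔ : ∀ {ℓ x y} → ℓ ≡ x ⊎ ℓ ≡ y → ℓ ≤ x ⊔ y
  ≤-⊔ {y = y} (inj₁ refl) = m≤m⊔n _ y
  ≤-⊔ {x = x} (inj₂ refl) = m≤n⊔m x _

  ≤-maxLabelᴬ : ∀ ℓ r → OccR ℓ r → ℓ ≤ maxLabelᴬ r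
  ≤-maxLabelᴬ ℓ (R□a _ _)    = ≤-⊔
  ≤-maxLabelᴬ ℓ (R[]a _ _ _) = ≤-⊔
  ≤-maxLabelᴬ ℓ (R⊗a _ _ _)  = ≤-⊔

  ≤-maxLabelᴿ : ∀ ℓ R → Any (OccR ℓ) R → ℓ ≤ maxLabelᴿ R
  ≤-maxLabelᴿ ℓ (r ∷ R) (here p)  = ≤-trans (≤-maxLabelᴬ ℓ r p) (m≤m⊔n _ _)
  ≤-maxLabelᴿ ℓ (r ∷ R) (there p) = ≤-trans (≤-maxLabelᴿ ℓ R p) (m≤n⊔m _ _)

  ≤-maxLabelᴳ : ∀ ℓ Γ → Any (OccF ℓ) Γ → ℓ ≤ maxLabelᴳ Γ
  ≤-maxLabelᴳ ℓ (f ∷ Γ) (here refl) = m≤m⊔n _ _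
  ≤-maxLabelᴳ ℓ (f ∷ Γ) (there p)   = ≤-trans (≤-maxLabelᴳ ℓ Γ p) (m≤n⊔m _ _)

  root-R< : ∀ {ℓ} → Any (OccR ℓ) R₀ → ℓ < B
  root-R< o = s≤s (≤-trans (≤-maxLabelᴿ _ R₀ o) (m≤m⊔n _ _))

  root-Γ< : ∀ {ℓ} → Any (OccF ℓ) Γ₀ → ℓ < B
  root-Γ< o = s≤s (≤-trans (≤-maxLabelᴳ _ Γ₀ o) (m≤n⊔m _ _))

  -- #stage k is the fresh label of the □-type rule applied at stage k; the other
  -- tags name the witnesses created by (IOA), (D2) and (D5¹) for the given labels.
  data Tag : Set where
    #stage : ℕ → Tag
    #ioa   : Vec ℕ n → Tag
    #d2    : Fin n → Label → Tag
    #d5    : Fin n → Label → Tag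

  Tag-enum : Enumeration Tag
  Tag-enum = retract (⊎-enum ℕ-enum (⊎-enum (Vec-enum ℕ-enum n) (⊎-enum Fin×ℕ Fin×ℕ))) from to from-to
    where
    Fin×ℕ = ×-enum (Fin-enum m) ℕ-enum
    from : _ → Tag
    from (inj₁ k)                       = #stage k
    from (inj₂ (inj₁ xs))               = #ioa xs
    from (inj₂ (inj₂ (inj₁ (i , x))))   = #d2 i x
    from (inj₂ (inj₂ (inj₂ (i , x))))   = #d5 i x
    to : Tag → _
    to (#stage k) = inj₁ k
    to (#ioa xs)  = inj₂ (inj₁ xs)
    to (#d2 i x)  = inj₂ (inj₂ (inj₁ (i , x)))
    to (#d5 i x)  = inj₂ (inj₂ (inj₂ (i , x)))
    from-to : ∀ t → from (to t) ≡ t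
    from-to (#stage k) = refl
    from-to (#ioa xs)  = refl
    from-to (#d2 i x)  = refl
    from-to (#d5 i x)  = refl

  abstract
    label : Tag → Label
    label t = B + index Tag-enum t

    label-injective : ∀ {s t} → label s ≡ label t → s ≡ t
    label-injective e = index-injective Tag-enum (+-cancelˡ-≡ B _ _ e)

    B≤label : ∀ t → B ≤ label t
    B≤label t = m≤m+n B _

  fresh : ℕ → Label
  fresh k = label (#stage k)

  ioa-label : Vec ℕ n → Label
  ioa-label xs = label (#ioa xs)

  d2-label d5-label : Fin n → Label → Label
  d2-label i x = label (#d2 i x)
  d5-label i x = label (#d5 i x)

  record Node : Set where
    constructor node
    field
      R : List (RAtom n)
      Γ : List (LFm n)
      D : D5Hist n
  open Node public

  Closed : Node → Set
  Closed N = Der X (D N) (R N) (Γ N)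

  Open : Node → Set
  Open N = ¬ Closed N

  Occurs : Label → Node → Set
  Occurs ℓ N = Any (OccR ℓ) (R N) ⊎ Any (OccF ℓ) (Γ N)

  occurs? : ∀ ℓ N → Dec (Occurs ℓ N)
  occurs? ℓ N = any? occR? (R N) ⊎-dec any? (λ f → ℓ ≟ proj₁ f) (Γ N)
    where
    occR? : ∀ r → Dec (OccR ℓ r)
    occR? (R□a x y)    = (ℓ ≟ x) ⊎-dec (ℓ ≟ y)
    occR? (R[]a _ x y) = (ℓ ≟ x) ⊎-dec (ℓ ≟ y)
    occR? (R⊗a _ x y)  = (ℓ ≟ x) ⊎-dec (ℓ ≟ y)

  Available : Label → Node → Set
  Available x N = x < B ⊎ Occurs x N

  available? : ∀ x N → Dec (Available x N)
  available? x N = (x <? B) ⊎-dec occurs? x N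

  -- A rule instance: the rule, its principal formula or atom (a position in
  -- Γ or R), and a route for its path side condition.
  data Rule : Set where
    formula : ℕ → List ℕ → ℕ → Rule
    ioa     : Vec ℕ n → Vec (List ℕ) n → Rule
    D1      : ℕ → List ℕ → Rule
    D2      : Fin n → Label → Rule
    D3      : ℕ → Rule
    D4      : ℕ → List ℕ → Rule
    D5¹     : Fin n → Label → Rule
    D5²     : Fin n → Label → Label → List ℕ → Rule

  Rule-enum : Enumeration Rule
  Rule-enum = retract
    (⊎-enum (×-enum ℕ-enum (×-enum routes ℕ-enum))
    (⊎-enum (×-enum (Vec-enum ℕ-enum n) (Vec-enum routes n))
    (⊎-enum (×-enum ℕ-enum routes)
    (⊎-enum (×-enum (Fin-enum m) ℕ-enum)
    (⊎-enum ℕ-enum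
    (⊎-enum (×-enum ℕ-enum routes)
    (⊎-enum (×-enum (Fin-enum m) ℕ-enum)
            (×-enum (Fin-enum m) (×-enum ℕ-enum (×-enum ℕ-enum routes))))))))))
    from to from-to
    where
    routes = List-enum ℕ-enum
    from : _ → Rule
    from (inj₁ (q , ps , j))                                                  = formula q ps j
    from (inj₂ (inj₁ (xs , pss)))                                             = ioa xs pss
    from (inj₂ (inj₂ (inj₁ (j , ps))))                                        = D1 j ps
    from (inj₂ (inj₂ (inj₂ (inj₁ (i , x)))))                                  = D2 i x
    from (inj₂ (inj₂ (inj₂ (inj₂ (inj₁ j)))))                                 = D3 j
    from (inj₂ (inj₂ (inj₂ (inj₂ (inj₂ (inj₁ (j , ps)))))))                   = D4 j ps
    from (inj₂ (inj₂ (inj₂ (inj₂ (inj₂ (inj₂ (inj₁ (i , x))))))))             = D5¹ i x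
    from (inj₂ (inj₂ (inj₂ (inj₂ (inj₂ (inj₂ (inj₂ (i , x , y , ps)))))))) = D5² i x y ps
    to : Rule → _
    to (formula q ps j)  = inj₁ (q , ps , j)
    to (ioa xs pss)      = inj₂ (inj₁ (xs , pss))
    to (D1 j ps)         = inj₂ (inj₂ (inj₁ (j , ps)))
    to (D2 i x)          = inj₂ (inj₂ (inj₂ (inj₁ (i , x))))
    to (D3 j)            = inj₂ (inj₂ (inj₂ (inj₂ (inj₁ j))))
    to (D4 j ps)         = inj₂ (inj₂ (inj₂ (inj₂ (inj₂ (inj₁ (j , ps))))))
    to (D5¹ i x)         = inj₂ (inj₂ (inj₂ (inj₂ (inj₂ (inj₂ (inj₁ (i , x)))))))
    to (D5² i x y ps)    = inj₂ (inj₂ (inj₂ (inj₂ (inj₂ (inj₂ (inj₂ (i , x , y , ps)))))))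
    from-to : ∀ r → from (to r) ≡ r
    from-to (formula q ps j) = refl
    from-to (ioa xs pss)     = refl
    from-to (D1 j ps)        = refl
    from-to (D2 i x)         = refl
    from-to (D3 j)           = refl
    from-to (D4 j ps)        = refl
    from-to (D5¹ i x)        = refl
    from-to (D5² i x y ps)   = refl

  abstract
    schedule : ℕ → Rule
    schedule = recurrent Rule-enum

    schedule-after : ∀ r k → ∃[ k′ ] k ≤ k′ × schedule k′ ≡ r
    schedule-after = recurrent-after Rule-enum

  data Outcome : Set where
    one : Node → Outcome
    two : Node → Node → Outcome

  child : Bool → Outcome → Node
  child _     (one N)   = N
  child false (two N _) = N
  child true  (two _ N) = N

  addR : Node → RAtom n → Node
  addR N r = node (R N ∷ʳ r) (Γ N) (D N)

  addΓ : Node → LFm n → Node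
  addΓ N f = node (R N) (Γ N ∷ʳ f) (D N)

  setΓ : Node → ℕ → LFm n → Node
  setΓ N q f = node (R N) (Γ N [ q ]≔ f) (D N)

  descend : Node → ℕ → RAtom n → LFm n → Node
  descend N q r f = node (R N ∷ʳ r) (Γ N [ q ]≔ f) (D N)

  addR-when : Node → Maybe (RAtom n) → Outcome
  addR-when N nothing  = one N
  addR-when N (just r) = one (addR N r)

  addΓ-when : Node → Fm n → Maybe Label → Outcome
  addΓ-when N φ nothing  = one N
  addΓ-when N φ (just y) = one (addΓ N (y , φ))

  ⊗-target : Fin n → Label → RAtom n → Maybe Label
  ⊗-target i x (R⊗a i′ x′ y) with i′ ≟ᶠ i | x′ ≟ x
  ... | yes _ | yes _ = just y
  ... | _     | _     = nothing
  ⊗-target i x _ = nothing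

  ⊗-target-just : ∀ i x r {y} → ⊗-target i x r ≡ just y → r ≡ R⊗a i x y
  ⊗-target-just i x (R⊗a i′ x′ y) e with i′ ≟ᶠ i | x′ ≟ x
  ⊗-target-just i x (R⊗a i′ x′ y) refl | yes refl | yes refl = refl

  ⊗-target-self : ∀ i x y → ⊗-target i x (R⊗a i x y) ≡ just y
  ⊗-target-self i x y with i ≟ᶠ i | x ≟ x
  ... | yes _ | yes _ = refl
  ... | no ne | _     = ⊥-elim (ne refl)
  ... | yes _ | no ne = ⊥-elim (ne refl)

  -- Only the
  -- ◇-type rules keep the principal formula (adding the instance reached by the
  -- route ps, or for ⊖ through the atom at position j); the other rules overwrite
  -- it in place, so the positions of all other formulas never change.
  decompose : ℕ → Node → ℕ → Label → Fm n → List ℕ → ℕ → Outcome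
  decompose k N q x (atom _)  _  _ = one N
  decompose k N q x (natom _) _  _ = one N
  decompose k N q x (φ ∨′ ψ)  _  _ = one (addΓ (setΓ N q (x , φ)) (x , ψ))
  decompose k N q x (φ ∧′ ψ)  _  _ = two (setΓ N q (x , φ)) (setΓ N q (x , ψ))
  decompose k N q x (□ φ)     _  _ = one (descend N q (R□a x (fresh k)) (fresh k , φ))
  decompose k N q x ([ i ] φ) _  _ = one (descend N q (R[]a i x (fresh k)) (fresh k , φ))
  decompose k N q x (⊗ i φ)   _  _ = one (descend N q (R⊗a i x (fresh k)) (fresh k , φ))
  decompose k N q x (◇ φ)     ps _ = addΓ-when N φ (walk◇ (R N) x ps)
  decompose k N q x (⟨ i ⟩ φ) ps _ = addΓ-when N φ (walk[ i ] (R N) x ps)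
  decompose k N q x (⊖ i φ)   _  j = addΓ-when N φ (R N !! j >>=ᵐ ⊗-target i x)

  decompose-at : ℕ → Node → ℕ → List ℕ → ℕ → Maybe (LFm n) → Outcome
  decompose-at k N q ps j nothing        = one N
  decompose-at k N q ps j (just (x , χ)) = decompose k N q x χ ps j

  x₀ : Vec ℕ n → Label
  x₀ xs = lookup xs fzero

  ioa-atoms : Vec ℕ n → List (RAtom n)
  ioa-atoms xs = map (λ i → R[]a i (lookup xs i) (ioa-label xs)) (allFin n)

  -- The routes pss lead from x₀ to every xᵢ; this gives the chain condition of (IOA).
  IOA-ready : Node → Vec ℕ n → Vec (List ℕ) n → Set
  IOA-ready N xs pss = Available (x₀ xs) N
                     × (∀ i → walk◇ (R N) (x₀ xs) (lookup pss i) ≡ just (lookup xs i))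
                     × ¬ Occurs (ioa-label xs) N

  IOA-ready? : ∀ N xs pss → Dec (IOA-ready N xs pss)
  IOA-ready? N xs pss = available? _ N ×-dec (all? (λ i → ≡-decᵐ _≟_ _ _) ×-dec ¬? (occurs? _ N))

  apply-IOA : Node → Vec ℕ n → Vec (List ℕ) n → Outcome
  apply-IOA N xs pss with IOA-ready? N xs pss
  ... | yes _ = one (node (R N ++ ioa-atoms xs) (Γ N) (D N))
  ... | no _  = one N

  apply-D1 : Node → List ℕ → Maybe (RAtom n) → Outcome
  apply-D1 N ps (just (R⊗a i x z)) = addR-when N (mapᵐ (λ y → R⊗a i y z) (walk◇ (R N) x ps))
  apply-D1 N ps _                  = one N

  -- (D2) and (D5¹) are applied only at labels already in use: a new label in an
  -- atom could otherwise be one that a later stage takes to be fresh.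
  D2-ready : Node → Fin n → Label → Set
  D2-ready N i x = T (d2 X) × Available x N × ¬ Occurs (d2-label i x) N

  D2-ready? : ∀ N i x → Dec (D2-ready N i x)
  D2-ready? N i x = T? (d2 X) ×-dec (available? x N ×-dec ¬? (occurs? _ N))

  apply-D2 : Node → Fin n → Label → Outcome
  apply-D2 N i x with D2-ready? N i x
  ... | yes _ = one (addR N (R⊗a i x (d2-label i x)))
  ... | no _  = one N

  apply-D3 : Node → Maybe (RAtom n) → Outcome
  apply-D3 N (just (R⊗a i x y)) with T? (d3 X)
  ... | yes _ = one (addR N (R□a x y))
  ... | no _  = one N
  apply-D3 N _ = one N

  apply-D4 : Node → List ℕ → Maybe (RAtom n) → Outcome
  apply-D4 N ps (just (R⊗a i x y)) with T? (d4 X)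
  ... | yes _ = addR-when N (mapᵐ (R⊗a i x) (walk[ i ] (R N) y ps))
  ... | no _  = one N
  apply-D4 N ps _ = one N

  D5¹-ready : Node → Fin n → Label → Set
  D5¹-ready N i x = T (d5 X) × Available x N × ¬ Occurs (d5-label i x) N

  D5¹-ready? : ∀ N i x → Dec (D5¹-ready N i x)
  D5¹-ready? N i x = T? (d5 X) ×-dec (available? x N ×-dec ¬? (occurs? _ N))

  apply-D5¹ : Node → Fin n → Label → Outcome
  apply-D5¹ N i x with D5¹-ready? N i x
  ... | yes _ = one (node (R N ∷ʳ R⊗a i x (d5-label i x)) (Γ N) ((i , x , d5-label i x) ∷ D N))
  ... | no _  = one N

  D5²-ready? : ∀ N i x y → Dec (T (d5 X) × (i , x , y) ∈ D N)
  D5²-ready? N i x y = T? (d5 X) ×-dec ((i , x , y) ∈? D N)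
    where open import Data.List.Membership.DecPropositional (≡-dec _≟ᶠ_ (≡-dec _≟_ _≟_)) using (_∈?_)

  apply-D5² : Node → Fin n → Label → Label → List ℕ → Outcome
  apply-D5² N i x y ps with D5²-ready? N i x y
  ... | yes _ = addR-when N (mapᵐ (R⊗a i x) (walk[ i ] (R N) y ps))
  ... | no _  = one N

  step : ℕ → Node → Rule → Outcome
  step k N (formula q ps j) = decompose-at k N q ps j (Γ N !! q)
  step k N (ioa xs pss)     = apply-IOA N xs pss
  step k N (D1 j ps)        = apply-D1 N ps (R N !! j)
  step k N (D2 i x)         = apply-D2 N i x
  step k N (D3 j)           = apply-D3 N (R N !! j)
  step k N (D4 j ps)        = apply-D4 N ps (R N !! j)
  step k N (D5¹ i x)        = apply-D5¹ N i x
  step k N (D5² i x y ps)   = apply-D5² N i x y ps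

  Justified : Node → Outcome → Set
  Justified N (one N′)    = Closed N′ → Closed N
  Justified N (two N₁ N₂) = Closed N₁ → Closed N₂ → Closed N

  module _ {D : D5Hist n} where

    permΓ : ∀ {R Γ Γ′} → Γ ↭ Γ′ → Der X D R Γ → Der X D R Γ′
    permΓ p = perm ↭-refl p

    permR : ∀ {R R′ Γ} → R ↭ R′ → Der X D R Γ → Der X D R′ Γ
    permR p = perm p ↭-refl

    -- The rules of the calculus act on the head of Γ; this moves position q there.
    principal : ∀ {R Γ q f} → Γ !! q ≡ just f → Der X D R (f ∷ remove Γ q) → Der X D R Γ
    principal {Γ = Γ} e = permΓ (↭-sym (remove-↭ Γ e))

  fresh-for : ∀ {y} N {Γ′} → ¬ Occurs y N → Γ N ↭ Γ′ → Fresh y (R N) Γ′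
  fresh-for N y∉N p = (λ o → y∉N (inj₁ o)) , (λ o → y∉N (inj₂ (Any-resp-↭ (↭-sym p) o)))

  Path◇-remove⊗ : ∀ (R : List (RAtom n)) {j i x y} → R !! j ≡ just (R⊗a i x y) →
                  ∀ {u v} → Path◇ R u v → Path◇ (remove R j) u v
  Path◇-remove⊗ R e = Path◇-mono (λ r∈R → ∈-remove R e r∈R (λ ())) (λ r∈R → ∈-remove R e r∈R (λ ()))

  Path[]-remove⊗ : ∀ (R : List (RAtom n)) {j i x y k} → R !! j ≡ just (R⊗a i x y) →
                   ∀ {u v} → Path[ k ] R u v → Path[ k ] (remove R j) u v
  Path[]-remove⊗ R e = Path[]-mono (λ r∈R → ∈-remove R e r∈R (λ ()))

  addΓ-◇-justified : ∀ N {q x φ ps} → Γ N !! q ≡ just (x , ◇ φ) →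
                     ∀ my → walk◇ (R N) x ps ≡ my → Justified N (addΓ-when N φ my)
  addΓ-◇-justified N e nothing  _  d = d
  addΓ-◇-justified N {ps = ps} e (just y) w d =
    principal e (◇r (walk◇⇒Path◇ (R N) _ ps w) (permΓ (∷ʳ-↭-remove (Γ N) (y , _) e) d))

  addΓ-⟨⟩-justified : ∀ N {q x i φ ps} → Γ N !! q ≡ just (x , ⟨ i ⟩ φ) →
                      ∀ my → walk[ i ] (R N) x ps ≡ my → Justified N (addΓ-when N φ my)
  addΓ-⟨⟩-justified N e nothing  _  d = d
  addΓ-⟨⟩-justified N {i = i} {ps = ps} e (just y) w d =
    principal e (⟨⟩r (walk[]⇒Path[] i (R N) _ ps w) (permΓ (∷ʳ-↭-remove (Γ N) (y , _) e) d))

  addΓ-⊖-justified : ∀ N {q x i φ j} → Γ N !! q ≡ just (x , ⊖ i φ) →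
                     ∀ my → (R N !! j >>=ᵐ ⊗-target i x) ≡ my → Justified N (addΓ-when N φ my)
  addΓ-⊖-justified N e nothing  _ d = d
  addΓ-⊖-justified N {x = x} {i} {j = j} e (just y) t d with >>=ᵐ-just (R N !! j) (⊗-target i x) t
  ... | r , eʳ , tʳ with ⊗-target-just i x r tʳ
  ... | refl =
    permR (↭-sym (remove-↭ (R N) eʳ))
      (principal e (⊖r (permΓ (∷ʳ-↭-remove (Γ N) (y , _) e) (permR (remove-↭ (R N) eʳ) d))))

  decompose-justified : ∀ k N q x χ ps j → ¬ Occurs (fresh k) N → Γ N !! q ≡ just (x , χ) →
                        Justified N (decompose k N q x χ ps j)
  decompose-justified k N q x (atom _)  ps j _ e d = d
  decompose-justified k N q x (natom _) ps j _ e d = d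
  decompose-justified k N q x (φ ∨′ ψ)  ps j _ e d =
    principal e (∨r (permΓ (≔∷ʳ-↭ (Γ N) _ _ e) d))
  decompose-justified k N q x (φ ∧′ ψ)  ps j _ e d₁ d₂ =
    principal e (∧r (permΓ (≔-↭ (Γ N) _ e) d₁) (permΓ (≔-↭ (Γ N) _ e) d₂))
  decompose-justified k N q x (□ φ)     ps j k∉N e d =
    principal e (□r (fresh-for N k∉N (remove-↭ (Γ N) e))
                     (permR (∷ʳ-↭ (R N) _) (permΓ (≔-↭ (Γ N) _ e) d)))
  decompose-justified k N q x ([ i ] φ) ps j k∉N e d =
    principal e ([]r (fresh-for N k∉N (remove-↭ (Γ N) e))
                     (permR (∷ʳ-↭ (R N) _) (permΓ (≔-↭ (Γ N) _ e) d)))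
  decompose-justified k N q x (⊗ i φ)   ps j k∉N e d =
    principal e (⊗r (fresh-for N k∉N (remove-↭ (Γ N) e))
                     (permR (∷ʳ-↭ (R N) _) (permΓ (≔-↭ (Γ N) _ e) d)))
  decompose-justified k N q x (◇ φ)     ps j _ e = addΓ-◇-justified N {ps = ps} e _ refl
  decompose-justified k N q x (⟨ i ⟩ φ) ps j _ e = addΓ-⟨⟩-justified N {ps = ps} e _ refl
  decompose-justified k N q x (⊖ i φ)   ps j _ e = addΓ-⊖-justified N e _ refl

  decompose-at-justified : ∀ k N q ps j → ¬ Occurs (fresh k) N → ∀ mf → Γ N !! q ≡ mf →
                           Justified N (decompose-at k N q ps j mf)
  decompose-at-justified k N q ps j _   nothing        _ d = d
  decompose-at-justified k N q ps j k∉N (just (x , χ)) e   = decompose-justified k N q x χ ps j k∉N e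

  IOA-justified : ∀ N xs pss → Justified N (apply-IOA N xs pss)
  IOA-justified N xs pss with IOA-ready? N xs pss
  ... | no _ = λ d → d
  ... | yes (_ , routes , c∉N) = IOA (lookup xs) (ioa-label xs) (fresh-for N c∉N ↭-refl) chain
    where
    chain : ∀ (j k : Fin n) → _ → Path◇ (R N) (lookup xs j) (lookup xs k)
    chain j k _ = walk◇⇒Path◇ (R N) _ (reverse (lookup pss j) ++ lookup pss k)
      (walk-++ step◇ (R N) _ (reverse (lookup pss j)) (lookup pss k)
        (walk◇-reverse (R N) (x₀ xs) (lookup pss j) (routes j)) (routes k))

  D1-justified : ∀ N j ps ma → R N !! j ≡ ma → Justified N (apply-D1 N ps ma)
  D1-justified N j ps nothing              _ d = d
  D1-justified N j ps (just (R□a _ _))     _ d = d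
  D1-justified N j ps (just (R[]a _ _ _))  _ d = d
  D1-justified N j ps (just (R⊗a i x z))   e = via-walk _ refl
    where
    via-walk : ∀ my → walk◇ (R N) x ps ≡ my → Justified N (addR-when N (mapᵐ (λ y → R⊗a i y z) my))
    via-walk nothing  _ d = d
    via-walk (just y) w d = permR (↭-sym (remove-↭ (R N) e))
      (D1r (Path◇-remove⊗ (R N) e (walk◇⇒Path◇ (R N) x ps w)) (permR (∷ʳ-↭-remove (R N) _ e) d))

  D2-justified : ∀ N i x → Justified N (apply-D2 N i x)
  D2-justified N i x with D2-ready? N i x
  ... | no _                 = λ d → d
  ... | yes (t , _ , c∉N) = λ d → D2r t (fresh-for N c∉N ↭-refl) (permR (∷ʳ-↭ (R N) _) d)

  D3-justified : ∀ N j ma → R N !! j ≡ ma → Justified N (apply-D3 N ma)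
  D3-justified N j nothing             _ d = d
  D3-justified N j (just (R□a _ _))    _ d = d
  D3-justified N j (just (R[]a _ _ _)) _ d = d
  D3-justified N j (just (R⊗a i x y))  e with T? (d3 X)
  ... | no _  = λ d → d
  ... | yes t = λ d → permR (↭-sym (remove-↭ (R N) e)) (D3r t (permR (∷ʳ-↭-remove (R N) _ e) d))

  D4-justified : ∀ N j ps ma → R N !! j ≡ ma → Justified N (apply-D4 N ps ma)
  D4-justified N j ps nothing             _ d = d
  D4-justified N j ps (just (R□a _ _))    _ d = d
  D4-justified N j ps (just (R[]a _ _ _)) _ d = d
  D4-justified N j ps (just (R⊗a i x y))  e with T? (d4 X)
  ... | no _  = λ d → d
  ... | yes t = via-walk _ refl
    where
    via-walk : ∀ mz → walk[ i ] (R N) y ps ≡ mz → Justified N (addR-when N (mapᵐ (R⊗a i x) mz))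
    via-walk nothing  _ d = d
    via-walk (just z) w d = permR (↭-sym (remove-↭ (R N) e))
      (D4r t (Path[]-remove⊗ (R N) e (walk[]⇒Path[] i (R N) y ps w)) (permR (∷ʳ-↭-remove (R N) _ e) d))

  D5¹-justified : ∀ N i x → Justified N (apply-D5¹ N i x)
  D5¹-justified N i x with D5¹-ready? N i x
  ... | no _              = λ d → d
  ... | yes (t , _ , c∉N) = λ d → D5¹r t (fresh-for N c∉N ↭-refl) (permR (∷ʳ-↭ (R N) _) d)

  D5²-justified : ∀ N i x y ps → Justified N (apply-D5² N i x y ps)
  D5²-justified N i x y ps with D5²-ready? N i x y
  ... | no _          = λ d → d
  ... | yes (t , xy∈D) = via-walk _ refl
    where
    via-walk : ∀ mz → walk[ i ] (R N) y ps ≡ mz → Justified N (addR-when N (mapᵐ (R⊗a i x) mz))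
    via-walk nothing  _ d = d
    via-walk (just z) w d = D5²r t xy∈D (walk[]⇒Path[] i (R N) y ps w) (permR (∷ʳ-↭ (R N) _) d)

  step-justified : ∀ k N r → ¬ Occurs (fresh k) N → Justified N (step k N r)
  step-justified k N (formula q ps j) k∉N = decompose-at-justified k N q ps j k∉N _ refl
  step-justified k N (ioa xs pss)     _   = IOA-justified N xs pss
  step-justified k N (D1 j ps)        _   = D1-justified N j ps _ refl
  step-justified k N (D2 i x)         _   = D2-justified N i x
  step-justified k N (D3 j)           _   = D3-justified N j _ refl
  step-justified k N (D4 j ps)        _   = D4-justified N j ps _ refl
  step-justified k N (D5¹ i x)        _   = D5¹-justified N i x
  step-justified k N (D5² i x y ps)   _   = D5²-justified N i x y ps

  -- A created label occurs only together with the atoms it was created for.  This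
  -- keeps fresh k unused at stage k, and lets a skipped (IOA), (D2) or (D5¹) step
  -- count as already done.
  Introduced : ℕ → Node → Tag → Set
  Introduced k N (#stage j) = j < k
  Introduced k N (#ioa xs)  = ∀ i → R[]a i (lookup xs i) (ioa-label xs) ∈ R N
  Introduced k N (#d2 i x)  = R⊗a i x (d2-label i x) ∈ R N
  Introduced k N (#d5 i x)  = (i , x , d5-label i x) ∈ D N × R⊗a i x (d5-label i x) ∈ R N

  Tagged : ℕ → Node → Label → Set
  Tagged k N ℓ = ∃[ t ] ℓ ≡ label t × Introduced k N t

  LabelsKnown : ℕ → Node → Set
  LabelsKnown k N = ∀ ℓ → Occurs ℓ N → ℓ < B ⊎ Tagged k N ℓ

  HistoryInR : Node → Set
  HistoryInR N = ∀ {i x y} → (i , x , y) ∈ D N → R⊗a i x y ∈ R N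

  Invariant : ℕ → Node → Set
  Invariant k N = LabelsKnown k N × HistoryInR N

  occurs⇒introduced : ∀ {k N} t → LabelsKnown k N → Occurs (label t) N → Introduced k N t
  occurs⇒introduced t known o with known _ o
  ... | inj₁ t<B = ⊥-elim (<-irrefl refl (≤-<-trans (B≤label t) t<B))
  ... | inj₂ (t′ , e , intro) with label-injective e
  ... | refl = intro

  fresh-unused : ∀ {k N} → LabelsKnown k N → ¬ Occurs (fresh k) N
  fresh-unused {k} known o = <-irrefl refl (occurs⇒introduced (#stage k) known o)

  infix 4 _⊑_
  record _⊑_ (N N′ : Node) : Set where
    field
      R-extension : ∃[ E ] R N′ ≡ R N ++ E
      D-⊆         : ∀ {t} → t ∈ D N → t ∈ D N′
  open _⊑_ public

  ⊑-refl : ∀ {N} → N ⊑ N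
  ⊑-refl {N} = record { R-extension = [] , sym (++-identityʳ (R N)) ; D-⊆ = λ p → p }

  ⊑-trans : ∀ {N₁ N₂ N₃} → N₁ ⊑ N₂ → N₂ ⊑ N₃ → N₁ ⊑ N₃
  ⊑-trans {N₁} ext₁ ext₂ with R-extension ext₁ | R-extension ext₂
  ... | E₁ , e₁ | E₂ , e₂ = record
    { R-extension = E₁ ++ E₂ , trans e₂ (trans (cong (_++ E₂) e₁) (++-assoc (R N₁) E₁ E₂))
    ; D-⊆         = λ p → D-⊆ ext₂ (D-⊆ ext₁ p)
    }

  ⊑-Any : ∀ {N N′} → N ⊑ N′ → ∀ {P : RAtom n → Set} → Any P (R N) → Any P (R N′)
  ⊑-Any ext p with R-extension ext
  ... | E , e rewrite e = ++⁺ˡ p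

  ⊑-!! : ∀ {N N′} → N ⊑ N′ → ∀ {j r} → R N !! j ≡ just r → R N′ !! j ≡ just r
  ⊑-!! {N} ext p with R-extension ext
  ... | E , e rewrite e = !!-++ (R N) p

  ⊑-walk : ∀ {N N′} → N ⊑ N′ → ∀ step {c ps y} → walk step (R N) c ps ≡ just y → walk step (R N′) c ps ≡ just y
  ⊑-walk {N} ext step {c} {ps} p with R-extension ext
  ... | E , e rewrite e = walk-extend step (R N) E c ps p

  Introduced-mono : ∀ {k k′ N N′} → k ≤ k′ → N ⊑ N′ → ∀ t → Introduced k N t → Introduced k′ N′ t
  Introduced-mono k≤k′ ext (#stage j) j<k         = <-≤-trans j<k k≤k′
  Introduced-mono k≤k′ ext (#ioa xs)  atoms i     = ⊑-Any ext (atoms i)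
  Introduced-mono k≤k′ ext (#d2 i x)  a∈R         = ⊑-Any ext a∈R
  Introduced-mono k≤k′ ext (#d5 i x)  (h , a∈R)   = D-⊆ ext h , ⊑-Any ext a∈R

  Γ-occurs : ∀ N {q x χ} → Γ N !! q ≡ just (x , χ) → Occurs x N
  Γ-occurs N e = inj₂ (lose (!!⇒∈ (Γ N) e) refl)

  R-occurs : ∀ N {r ℓ} → r ∈ R N → OccR ℓ r → Occurs ℓ N
  R-occurs N r∈R o = inj₁ (lose r∈R o)

  walk◇-available : ∀ N {x ps y} → walk◇ (R N) x ps ≡ just y → Available x N → Available y N
  walk◇-available N {x} {ps} w a with walk◇-end (R N) x ps w
  ... | inj₁ refl = a
  ... | inj₂ o    = inj₂ (inj₁ o)

  walk[]-available : ∀ N {i x ps y} → walk[ i ] (R N) x ps ≡ just y → Available x N → Available y N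
  walk[]-available N {i} {x} {ps} w = walk◇-available N {ps = ps} (walk[]⇒walk◇ i (R N) x ps w)

  data Accounted (k : ℕ) (N N′ : Node) (ℓ : Label) : Set where
    available : Available ℓ N → Accounted k N N′ ℓ
    tagged    : Tagged (suc k) N′ ℓ → Accounted k N N′ ℓ

  record Conservative (k : ℕ) (N N′ : Node) : Set where
    field
      extends       : N ⊑ N′
      accounted     : ∀ ℓ → Occurs ℓ N′ → Accounted k N N′ ℓ
      keeps-history : HistoryInR N → HistoryInR N′
  open Conservative

  conservative-invariant : ∀ {k N N′} → Invariant k N → Conservative k N N′ → Invariant (suc k) N′
  conservative-invariant {k} {N} {N′} (known , hist) c = known′ , keeps-history c hist
    where
    known′ : LabelsKnown (suc k) N′
    known′ ℓ o with accounted c ℓ o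
    ... | tagged t             = inj₂ t
    ... | available (inj₁ ℓ<B) = inj₁ ℓ<B
    ... | available (inj₂ o′) with known ℓ o′
    ... | inj₁ ℓ<B             = inj₁ ℓ<B
    ... | inj₂ (t , e , intro) = inj₂ (t , e , Introduced-mono (n≤1+n k) (extends c) t intro)

  conservative-refl : ∀ {k N} → Conservative k N N
  conservative-refl = record
    { extends = ⊑-refl ; accounted = λ ℓ o → available (inj₂ o) ; keeps-history = λ h → h }

  conservative-by : ∀ {k N N′} E → R N′ ≡ R N ++ E → D N′ ≡ D N →
                    (∀ ℓ → Any (OccR ℓ) E → Accounted k N N′ ℓ) →
                    (∀ ℓ → Any (OccF ℓ) (Γ N′) → Accounted k N N′ ℓ) → Conservative k N N′
  conservative-by {k} {N} {N′} E eR eD new-R new-Γ = record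
    { extends       = ext
    ; accounted     = accounted′
    ; keeps-history = λ hist p → ⊑-Any ext (hist (subst (_ ∈_) eD p))
    }
    where
    ext : N ⊑ N′
    ext = record { R-extension = E , eR ; D-⊆ = subst (_ ∈_) (sym eD) }
    accounted′ : ∀ ℓ → Occurs ℓ N′ → Accounted k N N′ ℓ
    accounted′ ℓ (inj₂ o) = new-Γ ℓ o
    accounted′ ℓ (inj₁ o) with ++⁻ (R N) (subst (Any (OccR ℓ)) eR o)
    ... | inj₁ p = available (inj₂ (inj₁ p))
    ... | inj₂ p = new-R ℓ p

  old-Γ : ∀ {k N N′ ℓ} → Any (OccF ℓ) (Γ N) → Accounted k N N′ ℓ
  old-Γ o = available (inj₂ (inj₂ o))

  addR-conservative : ∀ {k} N r → (∀ ℓ → OccR ℓ r → Available ℓ N) → Conservative k N (addR N r)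
  addR-conservative N r new =
    conservative-by (r ∷ []) refl refl (λ { ℓ (here o) → available (new ℓ o) }) (λ ℓ → old-Γ)

  addΓ-when-conservative : ∀ {k} N φ my → (∀ {y} → my ≡ just y → Available y N) → ∀ b →
                           Conservative k N (child b (addΓ-when N φ my))
  addΓ-when-conservative N φ nothing  _     b = conservative-refl
  addΓ-when-conservative N φ (just y) avail b =
    conservative-by [] (sym (++-identityʳ (R N))) refl (λ ℓ ()) new-Γ
    where
    new-Γ : ∀ {k} ℓ → Any (OccF ℓ) (Γ N ∷ʳ (y , φ)) → Accounted k N (addΓ N (y , φ)) ℓ
    new-Γ ℓ o with Any-∷ʳ (Γ N) o
    ... | inj₁ p    = old-Γ p
    ... | inj₂ refl = available (avail refl)

  setΓ-accounted : ∀ {k} N N′ {q x χ} → Γ N !! q ≡ just (x , χ) → ∀ {y φ} → Accounted k N N′ y →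
                   ∀ ℓ → Any (OccF ℓ) (Γ N [ q ]≔ (y , φ)) → Accounted k N N′ ℓ
  setΓ-accounted N N′ {q} e acc ℓ o with Any-≔ (Γ N) q _ o
  ... | inj₁ p    = old-Γ p
  ... | inj₂ refl = acc

  ∨-conservative : ∀ {k} N {q x φ ψ} → Γ N !! q ≡ just (x , φ ∨′ ψ) →
                   Conservative k N (addΓ (setΓ N q (x , φ)) (x , ψ))
  ∨-conservative N {q} {x} {φ} {ψ} e =
    conservative-by [] (sym (++-identityʳ (R N))) refl (λ ℓ ()) new-Γ
    where
    new-Γ : ∀ {k} ℓ → Any (OccF ℓ) ((Γ N [ q ]≔ (x , φ)) ∷ʳ (x , ψ)) →
            Accounted k N (addΓ (setΓ N q (x , φ)) (x , ψ)) ℓ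
    new-Γ ℓ o with Any-∷ʳ (Γ N [ q ]≔ (x , φ)) o
    ... | inj₁ p    = setΓ-accounted N _ e (available (inj₂ (Γ-occurs N e))) ℓ p
    ... | inj₂ refl = available (inj₂ (Γ-occurs N e))

  setΓ-conservative : ∀ {k} N {q x χ} φ → Γ N !! q ≡ just (x , χ) → Conservative k N (setΓ N q (x , φ))
  setΓ-conservative N φ e = conservative-by [] (sym (++-identityʳ (R N))) refl (λ ℓ ())
                              (setΓ-accounted N _ e (available (inj₂ (Γ-occurs N e))))

  descend-conservative : ∀ k N {q x χ} r φ → Γ N !! q ≡ just (x , χ) →
                         (∀ ℓ → OccR ℓ r → ℓ ≡ x ⊎ ℓ ≡ fresh k) →
                         Conservative k N (descend N q r (fresh k , φ))
  descend-conservative k N {q} r φ e ends = conservative-by (r ∷ []) refl refl new-R (setΓ-accounted N N′ e new)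
    where
    N′ = descend N q r (fresh k , φ)
    new : Accounted k N N′ (fresh k)
    new = tagged (#stage k , refl , ≤-refl)
    new-R : ∀ ℓ → Any (OccR ℓ) (r ∷ []) → Accounted k N N′ ℓ
    new-R ℓ (here o) with ends ℓ o
    ... | inj₁ refl = available (inj₂ (Γ-occurs N e))
    ... | inj₂ refl = new

  decompose-conservative : ∀ k N q x χ ps j b → Γ N !! q ≡ just (x , χ) →
                           Conservative k N (child b (decompose k N q x χ ps j))
  decompose-conservative k N q x (atom _)  ps j b     e = conservative-refl
  decompose-conservative k N q x (natom _) ps j b     e = conservative-refl
  decompose-conservative k N q x (φ ∨′ ψ)  ps j b     e = ∨-conservative N e
  decompose-conservative k N q x (φ ∧′ ψ)  ps j false e = setΓ-conservative N φ e
  decompose-conservative k N q x (φ ∧′ ψ)  ps j true  e = setΓ-conservative N ψ e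
  decompose-conservative k N q x (□ φ)     ps j b     e = descend-conservative k N _ φ e (λ _ o → o)
  decompose-conservative k N q x ([ i ] φ) ps j b     e = descend-conservative k N _ φ e (λ _ o → o)
  decompose-conservative k N q x (⊗ i φ)   ps j b     e = descend-conservative k N _ φ e (λ _ o → o)
  decompose-conservative k N q x (◇ φ)     ps j b     e =
    addΓ-when-conservative N φ _ (λ w → walk◇-available N {ps = ps} w (inj₂ (Γ-occurs N e))) b
  decompose-conservative k N q x (⟨ i ⟩ φ) ps j b     e =
    addΓ-when-conservative N φ _ (λ w → walk[]-available N {i = i} {ps = ps} w (inj₂ (Γ-occurs N e))) b
  decompose-conservative k N q x (⊖ i φ)   ps j b     e = addΓ-when-conservative N φ _ target-available b
    where
    target-available : ∀ {y} → (R N !! j >>=ᵐ ⊗-target i x) ≡ just y → Available y N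
    target-available t with >>=ᵐ-just (R N !! j) (⊗-target i x) t
    ... | r , eʳ , tʳ with ⊗-target-just i x r tʳ
    ... | refl = inj₂ (R-occurs N (!!⇒∈ (R N) eʳ) (inj₂ refl))

  decompose-at-conservative : ∀ k N q ps j b mf → Γ N !! q ≡ mf →
                              Conservative k N (child b (decompose-at k N q ps j mf))
  decompose-at-conservative k N q ps j b nothing        _ = conservative-refl
  decompose-at-conservative k N q ps j b (just (x , χ)) e = decompose-conservative k N q x χ ps j b e

  IOA-conservative : ∀ k N xs pss b → Conservative k N (child b (apply-IOA N xs pss))
  IOA-conservative k N xs pss b with IOA-ready? N xs pss
  ... | no _                   = conservative-refl
  ... | yes (avail , routes , _) = conservative-by (ioa-atoms xs) refl refl new-R (λ ℓ → old-Γ)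
    where
    N′ = node (R N ++ ioa-atoms xs) (Γ N) (D N)
    new-R : ∀ ℓ → Any (OccR ℓ) (ioa-atoms xs) → Accounted k N N′ ℓ
    new-R ℓ o with satisfied (map⁻ {xs = allFin n} o)
    ... | i , inj₁ refl = available (walk◇-available N {ps = lookup pss i} (routes i) avail)
    ... | i , inj₂ refl = tagged (#ioa xs , refl , λ i′ → ++⁺ʳ (R N) (∈-map⁺ _ (∈-allFin i′)))

  D1-conservative : ∀ k N j ps b ma → R N !! j ≡ ma → Conservative k N (child b (apply-D1 N ps ma))
  D1-conservative k N j ps b nothing             _ = conservative-refl
  D1-conservative k N j ps b (just (R□a _ _))    _ = conservative-refl
  D1-conservative k N j ps b (just (R[]a _ _ _)) _ = conservative-refl
  D1-conservative k N j ps b (just (R⊗a i x z))  e = via-walk _ refl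
    where
    xz∈R = !!⇒∈ (R N) e
    via-walk : ∀ my → walk◇ (R N) x ps ≡ my →
               Conservative k N (child b (addR-when N (mapᵐ (λ y → R⊗a i y z) my)))
    via-walk nothing  _ = conservative-refl
    via-walk (just y) w = addR-conservative N _ λ
      { _ (inj₁ refl) → walk◇-available N {ps = ps} w (inj₂ (R-occurs N xz∈R (inj₁ refl)))
      ; _ (inj₂ refl) → inj₂ (R-occurs N xz∈R (inj₂ refl)) }

  D2-conservative : ∀ k N i x b → Conservative k N (child b (apply-D2 N i x))
  D2-conservative k N i x b with D2-ready? N i x
  ... | no _              = conservative-refl
  ... | yes (_ , avail , _) = conservative-by (_ ∷ []) refl refl new-R (λ ℓ → old-Γ)
    where
    new-R : ∀ ℓ → Any (OccR ℓ) (R⊗a i x (d2-label i x) ∷ []) →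
            Accounted k N (addR N (R⊗a i x (d2-label i x))) ℓ
    new-R ℓ (here (inj₁ refl)) = available avail
    new-R ℓ (here (inj₂ refl)) = tagged (#d2 i x , refl , ++⁺ʳ (R N) (here refl))

  D3-conservative : ∀ k N j b ma → R N !! j ≡ ma → Conservative k N (child b (apply-D3 N ma))
  D3-conservative k N j b nothing             _ = conservative-refl
  D3-conservative k N j b (just (R□a _ _))    _ = conservative-refl
  D3-conservative k N j b (just (R[]a _ _ _)) _ = conservative-refl
  D3-conservative k N j b (just (R⊗a i x y))  e with T? (d3 X)
  ... | no _ = conservative-refl
  ... | yes _ = addR-conservative N _ λ
    { _ (inj₁ refl) → inj₂ (R-occurs N (!!⇒∈ (R N) e) (inj₁ refl))
    ; _ (inj₂ refl) → inj₂ (R-occurs N (!!⇒∈ (R N) e) (inj₂ refl)) }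

  D4-conservative : ∀ k N j ps b ma → R N !! j ≡ ma → Conservative k N (child b (apply-D4 N ps ma))
  D4-conservative k N j ps b nothing             _ = conservative-refl
  D4-conservative k N j ps b (just (R□a _ _))    _ = conservative-refl
  D4-conservative k N j ps b (just (R[]a _ _ _)) _ = conservative-refl
  D4-conservative k N j ps b (just (R⊗a i x y))  e with T? (d4 X)
  ... | no _  = conservative-refl
  ... | yes _ = via-walk _ refl
    where
    xy∈R = !!⇒∈ (R N) e
    via-walk : ∀ mz → walk[ i ] (R N) y ps ≡ mz →
               Conservative k N (child b (addR-when N (mapᵐ (R⊗a i x) mz)))
    via-walk nothing  _ = conservative-refl
    via-walk (just z) w = addR-conservative N _ λ
      { _ (inj₁ refl) → inj₂ (R-occurs N xy∈R (inj₁ refl))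
      ; _ (inj₂ refl) → walk[]-available N {i = i} {ps = ps} w (inj₂ (R-occurs N xy∈R (inj₂ refl))) }

  D5¹-conservative : ∀ k N i x b → Conservative k N (child b (apply-D5¹ N i x))
  D5¹-conservative k N i x b with D5¹-ready? N i x
  ... | no _                = conservative-refl
  ... | yes (_ , avail , _) = record { extends = ext ; accounted = accounted′ ; keeps-history = history′ }
    where
    c  = d5-label i x
    N′ = node (R N ∷ʳ R⊗a i x c) (Γ N) ((i , x , c) ∷ D N)
    ext : N ⊑ N′
    ext = record { R-extension = _ , refl ; D-⊆ = there }
    accounted′ : ∀ ℓ → Occurs ℓ N′ → Accounted k N N′ ℓ
    accounted′ ℓ (inj₂ o) = old-Γ o
    accounted′ ℓ (inj₁ o) with Any-∷ʳ (R N) o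
    ... | inj₁ p           = available (inj₂ (inj₁ p))
    ... | inj₂ (inj₁ refl) = available avail
    ... | inj₂ (inj₂ refl) = tagged (#d5 i x , refl , here refl , ++⁺ʳ (R N) (here refl))
    history′ : HistoryInR N → HistoryInR N′
    history′ hist (here refl) = ++⁺ʳ (R N) (here refl)
    history′ hist (there p)   = ⊑-Any ext (hist p)

  D5²-conservative : ∀ k N i x y ps b → HistoryInR N → Conservative k N (child b (apply-D5² N i x y ps))
  D5²-conservative k N i x y ps b hist with D5²-ready? N i x y
  ... | no _           = conservative-refl
  ... | yes (_ , xy∈D) = via-walk _ refl
    where
    xy∈R = hist xy∈D
    via-walk : ∀ mz → walk[ i ] (R N) y ps ≡ mz →
               Conservative k N (child b (addR-when N (mapᵐ (R⊗a i x) mz)))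
    via-walk nothing  _ = conservative-refl
    via-walk (just z) w = addR-conservative N _ λ
      { _ (inj₁ refl) → inj₂ (R-occurs N xy∈R (inj₁ refl))
      ; _ (inj₂ refl) → walk[]-available N {i = i} {ps = ps} w (inj₂ (R-occurs N xy∈R (inj₂ refl))) }

  step-conservative : ∀ k N → HistoryInR N → ∀ r b → Conservative k N (child b (step k N r))
  step-conservative k N _    (formula q ps j) b = decompose-at-conservative k N q ps j b _ refl
  step-conservative k N _    (ioa xs pss)     b = IOA-conservative k N xs pss b
  step-conservative k N _    (D1 j ps)        b = D1-conservative k N j ps b _ refl
  step-conservative k N _    (D2 i x)         b = D2-conservative k N i x b
  step-conservative k N _    (D3 j)           b = D3-conservative k N j b _ refl
  step-conservative k N _    (D4 j ps)        b = D4-conservative k N j ps b _ refl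
  step-conservative k N _    (D5¹ i x)        b = D5¹-conservative k N i x b
  step-conservative k N hist (D5² i x y ps)   b = D5²-conservative k N i x y ps b hist

  invariant-step : ∀ k N → Invariant k N → ∀ r b → Invariant (suc k) (child b (step k N r))
  invariant-step k N inv r b = conservative-invariant inv (step-conservative k N (proj₂ inv) r b)

  -- The formulas that a step replaces by their components; all others persist.
  Consumed : Fm n → Set
  Consumed (_ ∨′ _) = ⊤
  Consumed (_ ∧′ _) = ⊤
  Consumed (□ _)    = ⊤
  Consumed ([ _ ] _) = ⊤
  Consumed (⊗ _ _)  = ⊤
  Consumed _        = ⊥

  addΓ-when-keeps : ∀ N φ my b {q f} → Γ N !! q ≡ just f → Γ (child b (addΓ-when N φ my)) !! q ≡ just f
  addΓ-when-keeps N φ nothing  b e = e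
  addΓ-when-keeps N φ (just y) b e = !!-++ (Γ N) e

  setΓ-keeps : ∀ N {q′ q f} g → Γ N !! q ≡ just f → q′ ≢ q → (Γ N [ q′ ]≔ g) !! q ≡ just f
  setΓ-keeps N {q′} {q} g e q′≢q = trans (≔-!!-other (Γ N) q′ q g q′≢q) e

  decompose-keeps : ∀ k N q′ x′ χ ps j b {q f} → Γ N !! q ≡ just f →
                    Γ (child b (decompose k N q′ x′ χ ps j)) !! q ≡ just f ⊎ (q′ ≡ q × Consumed χ)
  decompose-keeps k N q′ x′ (atom p)  ps j b e = inj₁ e
  decompose-keeps k N q′ x′ (natom p) ps j b e = inj₁ e
  decompose-keeps k N q′ x′ (◇ φ)     ps j b e = inj₁ (addΓ-when-keeps N φ (walk◇ (R N) x′ ps) b e)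
  decompose-keeps k N q′ x′ (⟨ i ⟩ φ) ps j b e = inj₁ (addΓ-when-keeps N φ (walk[ i ] (R N) x′ ps) b e)
  decompose-keeps k N q′ x′ (⊖ i φ)   ps j b e =
    inj₁ (addΓ-when-keeps N φ (R N !! j >>=ᵐ ⊗-target i x′) b e)
  decompose-keeps k N q′ x′ (φ ∨′ ψ)  ps j b {q} e with q′ ≟ q
  ... | yes q′≡q = inj₂ (q′≡q , tt)
  ... | no q′≢q  = inj₁ (!!-++ (Γ N [ q′ ]≔ _) (setΓ-keeps N _ e q′≢q))
  decompose-keeps k N q′ x′ (φ ∧′ ψ)  ps j b {q} e with q′ ≟ q | b
  ... | yes q′≡q | _     = inj₂ (q′≡q , tt)
  ... | no q′≢q  | false = inj₁ (setΓ-keeps N _ e q′≢q)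
  ... | no q′≢q  | true  = inj₁ (setΓ-keeps N _ e q′≢q)
  decompose-keeps k N q′ x′ (□ φ)     ps j b {q} e with q′ ≟ q
  ... | yes q′≡q = inj₂ (q′≡q , tt)
  ... | no q′≢q  = inj₁ (setΓ-keeps N _ e q′≢q)
  decompose-keeps k N q′ x′ ([ i ] φ) ps j b {q} e with q′ ≟ q
  ... | yes q′≡q = inj₂ (q′≡q , tt)
  ... | no q′≢q  = inj₁ (setΓ-keeps N _ e q′≢q)
  decompose-keeps k N q′ x′ (⊗ i φ)   ps j b {q} e with q′ ≟ q
  ... | yes q′≡q = inj₂ (q′≡q , tt)
  ... | no q′≢q  = inj₁ (setΓ-keeps N _ e q′≢q)

  decompose-at-keeps : ∀ k N q′ ps j b mf → Γ N !! q′ ≡ mf → ∀ {q f} → Γ N !! q ≡ just f →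
                       Γ (child b (decompose-at k N q′ ps j mf)) !! q ≡ just f ⊎ (q′ ≡ q × Consumed (proj₂ f))
  decompose-at-keeps k N q′ ps j b nothing          _  e = inj₁ e
  decompose-at-keeps k N q′ ps j b (just (x′ , χ′)) e′ e with decompose-keeps k N q′ x′ χ′ ps j b e
  ... | inj₁ kept = inj₁ kept
  ... | inj₂ (refl , consumed) with trans (sym e′) e
  ... | refl = inj₂ (refl , consumed)

  addR-when-Γ : ∀ N mr b → Γ (child b (addR-when N mr)) ≡ Γ N
  addR-when-Γ N nothing  b = refl
  addR-when-Γ N (just _) b = refl

  IOA-Γ : ∀ N xs pss b → Γ (child b (apply-IOA N xs pss)) ≡ Γ N
  IOA-Γ N xs pss b with IOA-ready? N xs pss
  ... | yes _ = refl
  ... | no _  = refl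

  D1-Γ : ∀ N ps b ma → Γ (child b (apply-D1 N ps ma)) ≡ Γ N
  D1-Γ N ps b nothing             = refl
  D1-Γ N ps b (just (R□a _ _))    = refl
  D1-Γ N ps b (just (R[]a _ _ _)) = refl
  D1-Γ N ps b (just (R⊗a i x z))  = addR-when-Γ N (mapᵐ (λ y → R⊗a i y z) (walk◇ (R N) x ps)) b

  D2-Γ : ∀ N i x b → Γ (child b (apply-D2 N i x)) ≡ Γ N
  D2-Γ N i x b with D2-ready? N i x
  ... | yes _ = refl
  ... | no _  = refl

  D3-Γ : ∀ N b ma → Γ (child b (apply-D3 N ma)) ≡ Γ N
  D3-Γ N b nothing             = refl
  D3-Γ N b (just (R□a _ _))    = refl
  D3-Γ N b (just (R[]a _ _ _)) = refl
  D3-Γ N b (just (R⊗a i x y)) with T? (d3 X)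
  ... | yes _ = refl
  ... | no _  = refl

  D4-Γ : ∀ N ps b ma → Γ (child b (apply-D4 N ps ma)) ≡ Γ N
  D4-Γ N ps b nothing             = refl
  D4-Γ N ps b (just (R□a _ _))    = refl
  D4-Γ N ps b (just (R[]a _ _ _)) = refl
  D4-Γ N ps b (just (R⊗a i x y)) with T? (d4 X)
  ... | yes _ = addR-when-Γ N (mapᵐ (R⊗a i x) (walk[ i ] (R N) y ps)) b
  ... | no _  = refl

  D5¹-Γ : ∀ N i x b → Γ (child b (apply-D5¹ N i x)) ≡ Γ N
  D5¹-Γ N i x b with D5¹-ready? N i x
  ... | yes _ = refl
  ... | no _  = refl

  D5²-Γ : ∀ N i x y ps b → Γ (child b (apply-D5² N i x y ps)) ≡ Γ N
  D5²-Γ N i x y ps b with D5²-ready? N i x y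
  ... | yes _ = addR-when-Γ N (mapᵐ (R⊗a i x) (walk[ i ] (R N) y ps)) b
  ... | no _  = refl

  step-keeps : ∀ k N r b {q f} → Γ N !! q ≡ just f →
               Γ (child b (step k N r)) !! q ≡ just f ⊎
               ∃[ ps ] ∃[ j ] r ≡ formula q ps j × Consumed (proj₂ f)
  step-keeps k N (formula q′ ps j) b e with decompose-at-keeps k N q′ ps j b _ refl e
  ... | inj₁ kept                = inj₁ kept
  ... | inj₂ (refl , consumed)   = inj₂ (ps , j , refl , consumed)
  step-keeps k N (ioa xs pss)     b e rewrite IOA-Γ N xs pss b = inj₁ e
  step-keeps k N (D1 j ps)        b e rewrite D1-Γ N ps b (R N !! j) = inj₁ e
  step-keeps k N (D2 i x)         b e rewrite D2-Γ N i x b = inj₁ e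
  step-keeps k N (D3 j)           b e rewrite D3-Γ N b (R N !! j) = inj₁ e
  step-keeps k N (D4 j ps)        b e rewrite D4-Γ N ps b (R N !! j) = inj₁ e
  step-keeps k N (D5¹ i x)        b e rewrite D5¹-Γ N i x b = inj₁ e
  step-keeps k N (D5² i x y ps)   b e rewrite D5²-Γ N i x y ps b = inj₁ e


  module _ (k : ℕ) (N : Node) (q : ℕ) (ps : List ℕ) (j : ℕ) (b : Bool) where

    private
      N′ = child b (step k N (formula q ps j))

    ∨-effect : ∀ {x φ ψ} → Γ N !! q ≡ just (x , φ ∨′ ψ) →
               Γ N′ !! q ≡ just (x , φ) × Γ N′ !! length (Γ N) ≡ just (x , ψ)
    ∨-effect {x} {φ} e rewrite e =
      !!-++ (Γ N [ q ]≔ _) (≔-!!-same (Γ N) _ e) ,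
      subst (λ l → ((Γ N [ q ]≔ (x , φ)) ∷ʳ _) !! l ≡ just _) (≔-length (Γ N) q _) (!!-∷ʳ (Γ N [ q ]≔ _))

    □-effect : ∀ {x φ} → Γ N !! q ≡ just (x , □ φ) →
               R□a x (fresh k) ∈ R N′ × Γ N′ !! q ≡ just (fresh k , φ)
    □-effect e rewrite e = ++⁺ʳ (R N) (here refl) , ≔-!!-same (Γ N) _ e

    []-effect : ∀ {x i φ} → Γ N !! q ≡ just (x , [ i ] φ) →
                R[]a i x (fresh k) ∈ R N′ × Γ N′ !! q ≡ just (fresh k , φ)
    []-effect e rewrite e = ++⁺ʳ (R N) (here refl) , ≔-!!-same (Γ N) _ e

    ⊗-effect : ∀ {x i φ} → Γ N !! q ≡ just (x , ⊗ i φ) →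
               R⊗a i x (fresh k) ∈ R N′ × Γ N′ !! q ≡ just (fresh k , φ)
    ⊗-effect e rewrite e = ++⁺ʳ (R N) (here refl) , ≔-!!-same (Γ N) _ e

    ◇-effect : ∀ {x φ y} → Γ N !! q ≡ just (x , ◇ φ) → walk◇ (R N) x ps ≡ just y →
               Γ N′ !! length (Γ N) ≡ just (y , φ)
    ◇-effect e w rewrite e | w = !!-∷ʳ (Γ N)

    ⟨⟩-effect : ∀ {x i φ y} → Γ N !! q ≡ just (x , ⟨ i ⟩ φ) → walk[ i ] (R N) x ps ≡ just y →
                Γ N′ !! length (Γ N) ≡ just (y , φ)
    ⟨⟩-effect e w rewrite e | w = !!-∷ʳ (Γ N)

    ⊖-effect : ∀ {x i φ y} → Γ N !! q ≡ just (x , ⊖ i φ) → R N !! j ≡ just (R⊗a i x y) →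
               Γ N′ !! length (Γ N) ≡ just (y , φ)
    ⊖-effect {x} {i} {y = y} e a rewrite e | a | ⊗-target-self i x y = !!-∷ʳ (Γ N)

  ∧-effect : ∀ k N q ps j b {x φ ψ} → Γ N !! q ≡ just (x , φ ∧′ ψ) →
             let N′ = child b (step k N (formula q ps j)) in
             Γ N′ !! q ≡ just (x , φ) ⊎ Γ N′ !! q ≡ just (x , ψ)
  ∧-effect k N q ps j false e rewrite e = inj₁ (≔-!!-same (Γ N) _ e)
  ∧-effect k N q ps j true  e rewrite e = inj₂ (≔-!!-same (Γ N) _ e)

  module _ (k : ℕ) (N : Node) (b : Bool) where

    IOA-effect : ∀ xs pss → LabelsKnown k N → Available (x₀ xs) N →
                 (∀ i → walk◇ (R N) (x₀ xs) (lookup pss i) ≡ just (lookup xs i)) →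
                 ∀ i → R[]a i (lookup xs i) (ioa-label xs) ∈ R (child b (step k N (ioa xs pss)))
    IOA-effect xs pss known avail routes i with IOA-ready? N xs pss
    ... | yes _ = ++⁺ʳ (R N) (∈-map⁺ _ (∈-allFin i))
    ... | no not-ready with occurs? (ioa-label xs) N
    ... | no c∉N = ⊥-elim (not-ready (avail , routes , c∉N))
    ... | yes c∈N = occurs⇒introduced (#ioa xs) known c∈N i

    D1-effect : ∀ j ps {i x z y} → R N !! j ≡ just (R⊗a i x z) → walk◇ (R N) x ps ≡ just y →
                R⊗a i y z ∈ R (child b (step k N (D1 j ps)))
    D1-effect j ps a w rewrite a | w = ++⁺ʳ (R N) (here refl)

    D2-effect : ∀ i x → LabelsKnown k N → T (d2 X) → Available x N →
                R⊗a i x (d2-label i x) ∈ R (child b (step k N (D2 i x)))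
    D2-effect i x known t avail with D2-ready? N i x
    ... | yes _ = ++⁺ʳ (R N) (here refl)
    ... | no not-ready with occurs? (d2-label i x) N
    ... | no c∉N  = ⊥-elim (not-ready (t , avail , c∉N))
    ... | yes c∈N = occurs⇒introduced (#d2 i x) known c∈N

    D3-effect : ∀ j {i x y} → T (d3 X) → R N !! j ≡ just (R⊗a i x y) → R□a x y ∈ R (child b (step k N (D3 j)))
    D3-effect j t a rewrite a with T? (d3 X)
    ... | yes _ = ++⁺ʳ (R N) (here refl)
    ... | no ¬t = ⊥-elim (¬t t)

    D4-effect : ∀ j ps {i x y z} → T (d4 X) → R N !! j ≡ just (R⊗a i x y) → walk[ i ] (R N) y ps ≡ just z →
                R⊗a i x z ∈ R (child b (step k N (D4 j ps)))
    D4-effect j ps t a w rewrite a with T? (d4 X)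
    ... | yes _ rewrite w = ++⁺ʳ (R N) (here refl)
    ... | no ¬t = ⊥-elim (¬t t)

    D5¹-effect : ∀ i x → LabelsKnown k N → T (d5 X) → Available x N →
                 let N′ = child b (step k N (D5¹ i x)) in
                 (i , x , d5-label i x) ∈ D N′ × R⊗a i x (d5-label i x) ∈ R N′
    D5¹-effect i x known t avail with D5¹-ready? N i x
    ... | yes _ = here refl , ++⁺ʳ (R N) (here refl)
    ... | no not-ready with occurs? (d5-label i x) N
    ... | no c∉N  = ⊥-elim (not-ready (t , avail , c∉N))
    ... | yes c∈N = occurs⇒introduced (#d5 i x) known c∈N

    D5²-effect : ∀ i x y ps {z} → T (d5 X) → (i , x , y) ∈ D N → walk[ i ] (R N) y ps ≡ just z →
                 R⊗a i x z ∈ R (child b (step k N (D5² i x y ps)))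
    D5²-effect i x y ps t xy∈D w with D5²-ready? N i x y
    ... | yes _ rewrite w = ++⁺ʳ (R N) (here refl)
    ... | no not-ready    = ⊥-elim (not-ready (t , xy∈D))

module Countermodel (m : ℕ) (X : Ext) (R₀ : List (RAtom (suc m))) (Γ₀ : List (LFm (suc m)))
                    (root-open : ¬ Der X [] R₀ Γ₀) where

  open Routes
  open ProofSearch m X R₀ Γ₀
  open RawMonad (¬¬-Monad {a = 0ℓ}) using (pure; _>>=_)

  root : Node
  root = node R₀ Γ₀ []

  -- Addresses in the search tree list the choices made, most recent first.
  nodeAt : List Bool → Node
  nodeAt []      = root
  nodeAt (b ∷ a) = child b (step (length a) (nodeAt a) (schedule (length a)))

  invariant-root : Invariant 0 root
  invariant-root = known , λ ()
    where
    known : LabelsKnown 0 root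
    known ℓ (inj₁ o) = inj₁ (root-R< o)
    known ℓ (inj₂ o) = inj₁ (root-Γ< o)

  invariant-at : ∀ a → Invariant (length a) (nodeAt a)
  invariant-at []      = invariant-root
  invariant-at (b ∷ a) = invariant-step (length a) (nodeAt a) (invariant-at a) (schedule (length a)) b

  OnBranch : List Bool → Set
  OnBranch []      = Open root
  OnBranch (b ∷ a) = OnBranch a × Open (nodeAt (b ∷ a)) × (b ≡ true → Closed (nodeAt (false ∷ a)))

  OnBranch⇒Open : ∀ {a} → OnBranch a → Open (nodeAt a)
  OnBranch⇒Open {[]}    g           = g
  OnBranch⇒Open {_ ∷ _} (_ , o , _) = o

  open-child : ∀ N o → Justified N o → Open N →
               ¬ ¬ (∃[ b ] Open (child b o) × (b ≡ true → Closed (child false o)))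
  open-child N (one N′)    justified N-open = pure (false , (λ d → N-open (justified d)) , λ ())
  open-child N (two N₁ N₂) justified N-open = ¬¬-excluded-middle >>= λ
    { (yes d₁) → pure (true , (λ d₂ → N-open (justified d₁ d₂)) , λ _ → d₁)
    ; (no ¬d₁) → pure (false , ¬d₁ , λ ()) }

  branch-continues : ∀ a → OnBranch a → ¬ ¬ (∃[ b ] OnBranch (b ∷ a))
  branch-continues a g =
    open-child (nodeAt a) _ (step-justified (length a) (nodeAt a) (schedule (length a))
                              (fresh-unused (proj₁ (invariant-at a))))
               (OnBranch⇒Open g)
    >>= λ (b , o , left-closed) → pure (b , g , o , left-closed)

  branch-reaches : ∀ k → ¬ ¬ (∃[ a ] length a ≡ k × OnBranch a)
  branch-reaches zero    = pure ([] , refl , root-open)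
  branch-reaches (suc k) = branch-reaches k >>= λ
    { (a , refl , g) → branch-continues a g >>= λ (b , g′) → pure (b ∷ a , refl , g′) }

  branch-unique : ∀ a b → OnBranch a → OnBranch b → length a ≡ length b → a ≡ b
  branch-unique []      []      _ _ _ = refl
  branch-unique (x ∷ a) (y ∷ b) (ga , oa , ca) (gb , ob , cb) e
    with branch-unique a b ga gb (suc-injective e)
  ... | refl with x | y
  ... | false | false = refl
  ... | true  | true  = refl
  ... | true  | false = ⊥-elim (ob (ca refl))
  ... | false | true  = ⊥-elim (oa (cb refl))

  infix 4 _≼_
  data _≼_ : List Bool → List Bool → Set where
    ≼-refl : ∀ {a} → a ≼ a
    ≼-step : ∀ {a b x} → a ≼ b → a ≼ (x ∷ b)

  ≼-OnBranch : ∀ {a b} → a ≼ b → OnBranch b → OnBranch a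
  ≼-OnBranch ≼-refl     g = g
  ≼-OnBranch (≼-step p) g = ≼-OnBranch p (proj₁ g)

  branch-≼ : ∀ a b → OnBranch a → OnBranch b → length a ≤ length b → a ≼ b
  branch-≼ []      []      _  _  _  = ≼-refl
  branch-≼ a       (y ∷ b) ga gb le with m≤n⇒m<n∨m≡n le
  ... | inj₂ eq         = subst (a ≼_) (branch-unique a (y ∷ b) ga gb eq) ≼-refl
  ... | inj₁ (s≤s lt) = ≼-step (branch-≼ a b ga (proj₁ gb) lt)

  branch-total : ∀ a b → OnBranch a → OnBranch b → a ≼ b ⊎ b ≼ a
  branch-total a b ga gb with ≤-total (length a) (length b)
  ... | inj₁ le = inj₁ (branch-≼ a b ga gb le)
  ... | inj₂ le = inj₂ (branch-≼ b a gb ga le)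

  ≼-⊑ : ∀ {a b} → a ≼ b → nodeAt a ⊑ nodeAt b
  ≼-⊑ ≼-refl                     = ⊑-refl
  ≼-⊑ (≼-step {b = b} {x = x} p) =
    ⊑-trans (≼-⊑ p) (Conservative.extends (step-conservative (length b) (nodeAt b)
                       (proj₂ (invariant-at b)) (schedule (length b)) x))

  Eventually : (List Bool → Set) → Set
  Eventually P = ∃[ a ] OnBranch a × P a

  Persistent : (List Bool → Set) → Set
  Persistent P = ∀ {a b} → a ≼ b → P a → P b

  -- The branch is linearly ordered, so two persistent facts hold at a common node.
  eventually-both : ∀ {P Q} → Persistent P → Persistent Q →
                    ¬ ¬ Eventually P → ¬ ¬ Eventually Q → ¬ ¬ Eventually (λ a → P a × Q a)
  eventually-both pP pQ evP evQ = evP >>= λ (a , ga , pa) → evQ >>= λ (b , gb , qb) →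
    pure (both a b ga gb pa qb (branch-total a b ga gb))
    where
    both : ∀ a b → OnBranch a → OnBranch b → _ → _ → a ≼ b ⊎ b ≼ a → Eventually _
    both a b ga gb pa qb (inj₁ a≼b) = b , gb , pP a≼b pa , qb
    both a b ga gb pa qb (inj₂ b≼a) = a , ga , pa , pQ b≼a qb

  fair : ∀ r a → OnBranch a →
         ¬ ¬ (∃[ b ] ∃[ bit ] a ≼ b × OnBranch (bit ∷ b) × schedule (length b) ≡ r)
  fair r a g with schedule-after r (length a)
  ... | k , a≤k , scheduled = branch-reaches (suc k) >>= λ
    { (bit ∷ b , e , g′) →
      pure (b , bit , branch-≼ a b g (proj₁ g′) (subst (length a ≤_) (sym (suc-injective e)) a≤k) ,
            g′ , subst (λ k′ → schedule k′ ≡ r) (sym (suc-injective e)) scheduled) }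

  after : ∀ b bit {r} → schedule (length b) ≡ r → (P : Node → Set) →
          P (child bit (step (length b) (nodeAt b) r)) → P (nodeAt (bit ∷ b))
  after b bit e P p = subst (λ r → P (child bit (step (length b) (nodeAt b) r))) (sym e) p

  applied-eventually : ∀ r {a} → OnBranch a → (P : Node → Set) →
                       (∀ b bit → a ≼ b → P (child bit (step (length b) (nodeAt b) r))) →
                       ¬ ¬ Eventually (P ∘ nodeAt)
  applied-eventually r {a} g P effect = fair r a g >>= λ (b , bit , a≼b , g′ , sch) →
    pure (bit ∷ b , g′ , after b bit sch P (effect b bit a≼b))

  Present : Label → List Bool → Set
  Present x a = x < B ⊎ Any (OccR x) (R (nodeAt a))

  Walk◇ : Label → Label → List Bool → Set
  Walk◇ x y a = ∃[ ps ] walk◇ (R (nodeAt a)) x ps ≡ just y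

  Walk[_] : Fin n → Label → Label → List Bool → Set
  Walk[ i ] x y a = ∃[ ps ] walk[ i ] (R (nodeAt a)) x ps ≡ just y

  InR : RAtom n → List Bool → Set
  InR r a = r ∈ R (nodeAt a)

  InD : Fin n × Label × Label → List Bool → Set
  InD t a = t ∈ D (nodeAt a)

  AtPos : ℕ → LFm n → List Bool → Set
  AtPos q f a = Γ (nodeAt a) !! q ≡ just f

  At : LFm n → List Bool → Set
  At f a = ∃[ q ] AtPos q f a

  Present-persistent : ∀ x → Persistent (Present x)
  Present-persistent x a≼b (inj₁ x<B) = inj₁ x<B
  Present-persistent x a≼b (inj₂ o)   = inj₂ (⊑-Any (≼-⊑ a≼b) o)

  Present⇒Available : ∀ {x a} → Present x a → Available x (nodeAt a)
  Present⇒Available (inj₁ x<B) = inj₁ x<B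
  Present⇒Available (inj₂ o)   = inj₂ (inj₁ o)

  Walk◇-persistent : ∀ x y → Persistent (Walk◇ x y)
  Walk◇-persistent x y a≼b (ps , w) = ps , ⊑-walk (≼-⊑ a≼b) step◇ {x} {ps} w

  Walk[]-persistent : ∀ i x y → Persistent (Walk[ i ] x y)
  Walk[]-persistent i x y a≼b (ps , w) = ps , ⊑-walk (≼-⊑ a≼b) step[ i ] {x} {ps} w

  InR-persistent : ∀ r → Persistent (InR r)
  InR-persistent r a≼b = ⊑-Any (≼-⊑ a≼b)

  InD-persistent : ∀ t → Persistent (InD t)
  InD-persistent t a≼b = D-⊆ (≼-⊑ a≼b)

  AtPos-persistent : ∀ {q f} → ¬ Consumed (proj₂ f) → Persistent (AtPos q f)
  AtPos-persistent kept ≼-refl e = e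
  AtPos-persistent kept (≼-step {b = b} {x = bit} a≼b) e
    with step-keeps (length b) (nodeAt b) (schedule (length b)) bit (AtPos-persistent kept a≼b e)
  ... | inj₁ e′                 = e′
  ... | inj₂ (_ , _ , _ , consumed) = ⊥-elim (kept consumed)

  At-persistent : ∀ {f} → ¬ Consumed (proj₂ f) → Persistent (At f)
  At-persistent kept a≼b (q , e) = q , AtPos-persistent kept a≼b e

  □atom⇒Walk◇ : ∀ {x y a} → InR (R□a x y) a → Walk◇ x y a
  □atom⇒Walk◇ {a = a} r∈R = let k , e = ∈⇒!! r∈R in k ∷ [] , walk◇-□edge (R (nodeAt a)) k e

  []atom⇒Walk[] : ∀ {i x y a} → InR (R[]a i x y) a → Walk[ i ] x y a
  []atom⇒Walk[] {i} {a = a} r∈R = let k , e = ∈⇒!! r∈R in k ∷ [] , walk[]-edge (R (nodeAt a)) k i e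

  eventually-all : ∀ k (P : Fin k → List Bool → Set) → (∀ i → Persistent (P i)) →
                   (∀ i → ¬ ¬ Eventually (P i)) → ¬ ¬ Eventually (λ a → ∀ i → P i a)
  eventually-all zero    P pP evP = pure ([] , root-open , λ ())
  eventually-all (suc k) P pP evP =
    eventually-both (pP fzero) (λ a≼b Pa i → pP (fsuc i) a≼b (Pa i)) (evP fzero)
                    (eventually-all k (P ∘ fsuc) (pP ∘ fsuc) (evP ∘ fsuc))
    >>= λ (a , g , P₀ , Pₛ) → pure (a , g , λ { fzero → P₀ ; (fsuc i) → Pₛ i })

  ProcessedBefore : ℕ → LFm n → List Bool → Set
  ProcessedBefore q f c =
    ∃[ b ] ∃[ bit ] ∃[ ps ] ∃[ j ] (bit ∷ b) ≼ c × AtPos q f b × schedule (length b) ≡ formula q ps j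

  persists-or-processed : ∀ {a c q f} → a ≼ c → AtPos q f a → AtPos q f c ⊎ ProcessedBefore q f c
  persists-or-processed ≼-refl e = inj₁ e
  persists-or-processed (≼-step {b = b} {x = bit} a≼b) e with persists-or-processed a≼b e
  ... | inj₂ (b′ , bit′ , ps , j , b′≼b , e′ , sch) = inj₂ (b′ , bit′ , ps , j , ≼-step b′≼b , e′ , sch)
  ... | inj₁ e′ with step-keeps (length b) (nodeAt b) (schedule (length b)) bit e′
  ... | inj₁ e″                 = inj₁ e″
  ... | inj₂ (ps , j , sch , _) = inj₂ (b , bit , ps , j , ≼-refl , e′ , sch)

  -- A formula on the branch is eventually principal: it is either consumed on
  -- the way or still at position q when the search next schedules position q.
  processed-eventually : ∀ {a q f} → OnBranch a → AtPos q f a → (P : Node → Set) →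
                         (∀ b bit ps j → AtPos q f b →
                            P (child bit (step (length b) (nodeAt b) (formula q ps j)))) →
                         ¬ ¬ Eventually (P ∘ nodeAt)
  processed-eventually {a} {q} g e P effect = fair (formula q [] 0) a g >>= λ (b , bit , a≼b , g′ , sch) →
    pure (case (persists-or-processed a≼b e) g′ sch)
    where
    case : ∀ {b bit} → AtPos q _ b ⊎ ProcessedBefore q _ b → OnBranch (bit ∷ b) →
           schedule (length b) ≡ formula q [] 0 → Eventually (P ∘ nodeAt)
    case {b} {bit} (inj₁ e′) g′ sch = bit ∷ b , g′ , after b bit sch P (effect b bit [] 0 e′)
    case (inj₂ (b′ , bit′ , ps , j , b′≼b , e′ , sch′)) g′ _ =
      bit′ ∷ b′ , ≼-OnBranch b′≼b (proj₁ g′) , after b′ bit′ sch′ P (effect b′ bit′ ps j e′)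

  World : Set
  World = Σ Label λ x → ¬ ¬ Eventually (Present x)

  ⌊_⌋ : World → Label
  ⌊_⌋ = proj₁

  atom-world : ∀ y {r} → ¬ ¬ Eventually (InR r) → OccR y r → World
  atom-world y ev o = y , (ev >>= λ (a , g , r∈R) → pure (a , g , inj₂ (lose r∈R o)))

  Rel□ : Label → Label → Set
  Rel□ x y = ¬ ¬ Eventually (Walk◇ x y)

  Rel[_] : Fin n → Label → Label → Set
  Rel[ i ] x y = ¬ ¬ Eventually (Walk[ i ] x y)

  Rel⊗ : Fin n → Label → Label → Set
  Rel⊗ i x y = ¬ ¬ Eventually (InR (R⊗a i x y))

  Val : Atm → Label → Set
  Val p x = ¬ ¬ Eventually (At (x , natom p))

  Rel□-refl : ∀ x → Rel□ x x
  Rel□-refl x = pure ([] , root-open , [] , refl)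

  Rel□-sym : ∀ {x y} → Rel□ x y → Rel□ y x
  Rel□-sym {x} r = r >>= λ (a , g , ps , w) → pure (a , g , reverse ps , walk◇-reverse (R (nodeAt a)) x ps w)

  Rel□-trans : ∀ {x y z} → Rel□ x y → Rel□ y z → Rel□ x z
  Rel□-trans {x} {y} {z} r₁ r₂ =
    eventually-both (Walk◇-persistent x y) (Walk◇-persistent y z) r₁ r₂ >>= λ
    (a , g , (ps , w₁) , (qs , w₂)) → pure (a , g , ps ++ qs , walk-++ step◇ (R (nodeAt a)) x ps qs w₁ w₂)

  Rel[]-refl : ∀ i x → Rel[ i ] x x
  Rel[]-refl i x = pure ([] , root-open , [] , refl)

  Rel[]-sym : ∀ i {x y} → Rel[ i ] x y → Rel[ i ] y x
  Rel[]-sym i {x} r = r >>= λ (a , g , ps , w) → pure (a , g , reverse ps , walk[]-reverse i (R (nodeAt a)) x ps w)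

  Rel[]-trans : ∀ i {x y z} → Rel[ i ] x y → Rel[ i ] y z → Rel[ i ] x z
  Rel[]-trans i {x} {y} {z} r₁ r₂ =
    eventually-both (Walk[]-persistent i x y) (Walk[]-persistent i y z) r₁ r₂ >>= λ
    (a , g , (ps , w₁) , (qs , w₂)) → pure (a , g , ps ++ qs , walk-++ step[ i ] (R (nodeAt a)) x ps qs w₁ w₂)

  Rel[]⇒Rel□ : ∀ i {x y} → Rel[ i ] x y → Rel□ x y
  Rel[]⇒Rel□ i {x} r = r >>= λ (a , g , ps , w) → pure (a , g , ps , walk[]⇒walk◇ i (R (nodeAt a)) x ps w)

  lookup-routes : ∀ {x a} {ys : Vec ℕ n} (W : ∀ i → Walk◇ x (lookup ys i) a) →
                  ∀ i → walk◇ (R (nodeAt a)) x (lookup (tabulate (proj₁ ∘ W)) i) ≡ just (lookup ys i)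
  lookup-routes {x} {a} W i = subst (λ ps → walk◇ (R (nodeAt a)) x ps ≡ just _)
                                     (sym (lookup∘tabulate (proj₁ ∘ W) i)) (proj₂ (W i))

  ioa-witness : ∀ xs → ¬ ¬ Eventually (Present (x₀ xs)) → (∀ i → Rel□ (x₀ xs) (lookup xs i)) →
                ¬ ¬ Eventually (λ a → ∀ i → InR (R[]a i (lookup xs i) (ioa-label xs)) a)
  ioa-witness xs present walks =
    eventually-both (Present-persistent (x₀ xs)) (λ a≼b W i → Walk◇-persistent (x₀ xs) (lookup xs i) a≼b (W i))
                    present (eventually-all n (λ i → Walk◇ (x₀ xs) (lookup xs i)) (λ i → Walk◇-persistent _ _) walks)
    >>= λ (a , g , P , W) →
    applied-eventually (ioa xs (tabulate (proj₁ ∘ W))) g (λ N → ∀ i → R[]a i (lookup xs i) (ioa-label xs) ∈ R N)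
      λ b bit a≼b → IOA-effect (length b) (nodeAt b) bit xs _ (proj₁ (invariant-at b))
        (Present⇒Available {a = b} (Present-persistent (x₀ xs) a≼b P))
        (λ i → ⊑-walk (≼-⊑ a≼b) step◇ {x₀ xs} {lookup (tabulate (proj₁ ∘ W)) i} (lookup-routes {a = a} {xs} W i))

  C3-holds : ∀ (w : World) (u : Fin n → World) → (∀ i → Rel□ ⌊ w ⌋ ⌊ u i ⌋) →
             Σ World λ v → ∀ i → Rel[ i ] ⌊ u i ⌋ ⌊ v ⌋
  C3-holds w u w-u = atom-world c (meet >>= λ (a , g , A) → pure (a , g , A fzero)) (inj₂ refl) , u-c
    where
    xs = tabulate (⌊_⌋ ∘ u)
    c  = ioa-label xs
    xs-u : ∀ i → lookup xs i ≡ ⌊ u i ⌋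
    xs-u = lookup∘tabulate (⌊_⌋ ∘ u)
    meet : ¬ ¬ Eventually (λ a → ∀ i → InR (R[]a i (lookup xs i) c) a)
    meet = ioa-witness xs (subst (λ x → ¬ ¬ Eventually (Present x)) (sym (xs-u fzero)) (proj₂ (u fzero)))
      λ i → subst₂ Rel□ (sym (xs-u fzero)) (sym (xs-u i)) (Rel□-trans (Rel□-sym (w-u fzero)) (w-u i))
    u-c : ∀ i → Rel[ i ] ⌊ u i ⌋ c
    u-c i = meet >>= λ (a , g , A) →
      pure (a , g , subst (λ x → Walk[ i ] x c a) (xs-u i) ([]atom⇒Walk[] {a = a} (A i)))

  Rel⊗-D1 : ∀ i {x y z} → Rel□ x y → Rel⊗ i x z → Rel⊗ i y z
  Rel⊗-D1 i {x} {y} {z} r₁ r₂ =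
    eventually-both (Walk◇-persistent x y) (InR-persistent (R⊗a i x z)) r₁ r₂
    >>= λ (a , g , (ps , w) , xz∈R) → let j , e = ∈⇒!! xz∈R in
    applied-eventually (D1 j ps) g (λ N → R⊗a i y z ∈ R N) λ b bit a≼b →
      D1-effect (length b) (nodeAt b) bit j ps (⊑-!! (≼-⊑ a≼b) e) (⊑-walk (≼-⊑ a≼b) step◇ {x} {ps} w)

  d2-witness : T (d2 X) → ∀ i x → ¬ ¬ Eventually (Present x) → Rel⊗ i x (d2-label i x)
  d2-witness t i x present = present >>= λ (a , g , P) →
    applied-eventually (D2 i x) g (λ N → R⊗a i x (d2-label i x) ∈ R N) λ b bit a≼b →
      D2-effect (length b) (nodeAt b) bit i x (proj₁ (invariant-at b)) t
        (Present⇒Available {a = b} (Present-persistent x a≼b P))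

  D2-holds : T (d2 X) → ∀ i (w : World) → Σ World λ v → Rel⊗ i ⌊ w ⌋ ⌊ v ⌋
  D2-holds t i (x , present) =
    atom-world (d2-label i x) (d2-witness t i x present) (inj₂ refl) , d2-witness t i x present

  Rel⊗⇒Rel□ : T (d3 X) → ∀ i {x y} → Rel⊗ i x y → Rel□ x y
  Rel⊗⇒Rel□ t i {x} {y} r = r >>= λ (a , g , xy∈R) → let j , e = ∈⇒!! xy∈R in
    applied-eventually (D3 j) g (λ N → R□a x y ∈ R N)
      (λ b bit a≼b → D3-effect (length b) (nodeAt b) bit j t (⊑-!! (≼-⊑ a≼b) e))
    >>= λ (c , g′ , xy∈R′) → pure (c , g′ , □atom⇒Walk◇ {a = c} xy∈R′)

  Rel⊗-D4 : T (d4 X) → ∀ i {x y z} → Rel⊗ i x y → Rel[ i ] y z → Rel⊗ i x z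
  Rel⊗-D4 t i {x} {y} {z} r₁ r₂ =
    eventually-both (InR-persistent (R⊗a i x y)) (Walk[]-persistent i y z) r₁ r₂
    >>= λ (a , g , xy∈R , (ps , w)) → let j , e = ∈⇒!! xy∈R in
    applied-eventually (D4 j ps) g (λ N → R⊗a i x z ∈ R N) λ b bit a≼b →
      D4-effect (length b) (nodeAt b) bit j ps t (⊑-!! (≼-⊑ a≼b) e) (⊑-walk (≼-⊑ a≼b) step[ i ] {y} {ps} w)

  d5-witness : T (d5 X) → ∀ i x → ¬ ¬ Eventually (Present x) →
               ¬ ¬ Eventually (λ a → InD (i , x , d5-label i x) a × InR (R⊗a i x (d5-label i x)) a)
  d5-witness t i x present = present >>= λ (a , g , P) →
    applied-eventually (D5¹ i x) g (λ N → (i , x , d5-label i x) ∈ D N × R⊗a i x (d5-label i x) ∈ R N)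
      λ b bit a≼b → D5¹-effect (length b) (nodeAt b) bit i x (proj₁ (invariant-at b)) t
        (Present⇒Available {a = b} (Present-persistent x a≼b P))

  d5-closure : T (d5 X) → ∀ i x y → ¬ ¬ Eventually (InD (i , x , y)) → ∀ z → Rel[ i ] y z → Rel⊗ i x z
  d5-closure t i x y hist z r =
    eventually-both (InD-persistent (i , x , y)) (Walk[]-persistent i y z) hist r
    >>= λ (a , g , xy∈D , (ps , w)) →
    applied-eventually (D5² i x y ps) g (λ N → R⊗a i x z ∈ R N) λ b bit a≼b →
      D5²-effect (length b) (nodeAt b) bit i x y ps t (InD-persistent _ a≼b xy∈D)
                 (⊑-walk (≼-⊑ a≼b) step[ i ] {y} {ps} w)

  D5-holds : T (d5 X) → ∀ i (w : World) →
             Σ World λ v → Rel⊗ i ⌊ w ⌋ ⌊ v ⌋ × (∀ u → Rel[ i ] ⌊ v ⌋ ⌊ u ⌋ → Rel⊗ i ⌊ w ⌋ ⌊ u ⌋)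
  D5-holds t i (x , present) =
    atom-world c x-c (inj₂ refl) , x-c ,
    λ u → d5-closure t i x c (witness >>= λ (a , g , xc∈D , _) → pure (a , g , xc∈D)) ⌊ u ⌋
    where
    c = d5-label i x
    witness = d5-witness t i x present
    x-c : Rel⊗ i x c
    x-c = witness >>= λ (a , g , _ , xc∈R) → pure (a , g , xc∈R)

  M : Model n X
  M = record
    { W         = World
    ; inhabited = 0 , pure ([] , root-open , inj₁ (s≤s z≤n))
    ; R□        = λ w v → Rel□ ⌊ w ⌋ ⌊ v ⌋
    ; R[_]      = λ i w v → Rel[ i ] ⌊ w ⌋ ⌊ v ⌋
    ; R⊗        = λ i w v → Rel⊗ i ⌊ w ⌋ ⌊ v ⌋
    ; V         = λ p w → Val p ⌊ w ⌋
    ; □-refl    = λ w → Rel□-refl ⌊ w ⌋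
    ; □-sym     = Rel□-sym
    ; □-trans   = Rel□-trans
    ; ag-refl   = λ i w → Rel[]-refl i ⌊ w ⌋
    ; ag-sym    = λ i → Rel[]-sym i
    ; ag-trans  = λ i → Rel[]-trans i
    ; ag⊆□      = λ i → Rel[]⇒Rel□ i
    ; C3        = C3-holds
    ; D1        = λ i → Rel⊗-D1 i
    ; D2        = D2-holds
    ; D3        = λ t i → Rel⊗⇒Rel□ t i
    ; D4        = λ t i → Rel⊗-D4 t i
    ; D5        = D5-holds
    }

  _⊩ᴹ_ : World → Fm n → Set
  _⊩ᴹ_ = _⊩_ M

  Appears : World → Fm n → Set
  Appears w φ = ¬ ¬ Eventually (At (⌊ w ⌋ , φ))

  Refuted : Fm n → Set
  Refuted φ = ∀ w → Appears w φ → ¬ w ⊩ᴹ φ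

  id-closed : ∀ {a x p q₁ q₂} → AtPos q₁ (x , atom p) a → AtPos q₂ (x , natom p) a → Closed (nodeAt a)
  id-closed {a} e₁ e₂ with ∈⇒!! (∈-remove (Γ (nodeAt a)) e₁ (!!⇒∈ (Γ (nodeAt a)) e₂) (λ ()))
  ... | _ , e₂′ = principal e₁ (permΓ (prep _ (↭-sym (remove-↭ _ e₂′))) id)

  refute-atom : ∀ p → Refuted (atom p)
  refute-atom p w appears sat =
    eventually-both (At-persistent (λ ())) (At-persistent (λ ())) appears sat
      λ (a , g , (_ , e₁) , (_ , e₂)) → OnBranch⇒Open g (id-closed {a} e₁ e₂)

  refute-∨ : ∀ {φ ψ} → Refuted φ → Refuted ψ → Refuted (φ ∨′ ψ)
  refute-∨ {φ} {ψ} ihφ ihψ w@(x , _) appears sat = appears λ (a , g , q , e) →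
    processed-eventually g e (λ N → Γ N !! q ≡ just (x , φ) × ∃[ p ] Γ N !! p ≡ just (x , ψ))
      (λ b bit ps j e′ → let eφ , eψ = ∨-effect (length b) (nodeAt b) q ps j bit e′ in eφ , _ , eψ)
    λ (c , g′ , eφ , eψ) → [ ihφ w (pure (c , g′ , q , eφ)) , ihψ w (pure (c , g′ , eψ)) ]′ sat

  refute-∧ : ∀ {φ ψ} → Refuted φ → Refuted ψ → Refuted (φ ∧′ ψ)
  refute-∧ {φ} {ψ} ihφ ihψ w@(x , _) appears (satφ , satψ) = appears λ (a , g , q , e) →
    processed-eventually g e (λ N → Γ N !! q ≡ just (x , φ) ⊎ Γ N !! q ≡ just (x , ψ))
      (λ b bit ps j e′ → ∧-effect (length b) (nodeAt b) q ps j bit e′)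
    λ (c , g′ , e′) → [ (λ eφ → ihφ w (pure (c , g′ , q , eφ)) satφ) ,
                        (λ eψ → ihψ w (pure (c , g′ , q , eψ)) satψ) ]′ e′

  refute-□ : ∀ {φ} → Refuted φ → Refuted (□ φ)
  refute-□ {φ} ih (x , _) appears sat = appears λ (a , g , q , e) →
    processed-eventually g e (λ N → ∃[ y ] R□a x y ∈ R N × Γ N !! q ≡ just (y , φ))
      (λ b bit ps j e′ → _ , □-effect (length b) (nodeAt b) q ps j bit e′)
    λ (c , g′ , y , xy∈R , eφ) → let wy = atom-world y (pure (c , g′ , xy∈R)) (inj₂ refl) in
    ih wy (pure (c , g′ , q , eφ)) (sat wy (pure (c , g′ , □atom⇒Walk◇ {a = c} xy∈R)))

  refute-[] : ∀ {i φ} → Refuted φ → Refuted ([ i ] φ)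
  refute-[] {i} {φ} ih (x , _) appears sat = appears λ (a , g , q , e) →
    processed-eventually g e (λ N → ∃[ y ] R[]a i x y ∈ R N × Γ N !! q ≡ just (y , φ))
      (λ b bit ps j e′ → _ , []-effect (length b) (nodeAt b) q ps j bit e′)
    λ (c , g′ , y , xy∈R , eφ) → let wy = atom-world y (pure (c , g′ , xy∈R)) (inj₂ refl) in
    ih wy (pure (c , g′ , q , eφ)) (sat wy (pure (c , g′ , []atom⇒Walk[] {a = c} xy∈R)))

  refute-⊗ : ∀ {i φ} → Refuted φ → Refuted (⊗ i φ)
  refute-⊗ {i} {φ} ih (x , _) appears sat = appears λ (a , g , q , e) →
    processed-eventually g e (λ N → ∃[ y ] R⊗a i x y ∈ R N × Γ N !! q ≡ just (y , φ))
      (λ b bit ps j e′ → _ , ⊗-effect (length b) (nodeAt b) q ps j bit e′)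
    λ (c , g′ , y , xy∈R , eφ) → let wy = atom-world y (pure (c , g′ , xy∈R)) (inj₂ refl) in
    ih wy (pure (c , g′ , q , eφ)) (sat wy (pure (c , g′ , xy∈R)))

  refute-◇ : ∀ {φ} → Refuted φ → Refuted (◇ φ)
  refute-◇ {φ} ih (x , _) appears (v@(y , _) , x-y , satφ) =
    eventually-both (At-persistent (λ ())) (Walk◇-persistent x y) appears x-y
    λ (a , g , (q , e) , (ps , w)) →
    ih v (applied-eventually (formula q ps 0) g (λ N → ∃[ p ] Γ N !! p ≡ just (y , φ)) λ b bit a≼b →
           _ , ◇-effect (length b) (nodeAt b) q ps 0 bit (AtPos-persistent (λ ()) a≼b e)
                        (⊑-walk (≼-⊑ a≼b) step◇ {x} {ps} w))
         satφ

  refute-⟨⟩ : ∀ {i φ} → Refuted φ → Refuted (⟨ i ⟩ φ)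
  refute-⟨⟩ {i} {φ} ih (x , _) appears (v@(y , _) , x-y , satφ) =
    eventually-both (At-persistent (λ ())) (Walk[]-persistent i x y) appears x-y
    λ (a , g , (q , e) , (ps , w)) →
    ih v (applied-eventually (formula q ps 0) g (λ N → ∃[ p ] Γ N !! p ≡ just (y , φ)) λ b bit a≼b →
           _ , ⟨⟩-effect (length b) (nodeAt b) q ps 0 bit (AtPos-persistent (λ ()) a≼b e)
                         (⊑-walk (≼-⊑ a≼b) step[ i ] {x} {ps} w))
         satφ

  refute-⊖ : ∀ {i φ} → Refuted φ → Refuted (⊖ i φ)
  refute-⊖ {i} {φ} ih (x , _) appears (v@(y , _) , x-y , satφ) =
    eventually-both (At-persistent (λ ())) (InR-persistent (R⊗a i x y)) appears x-y
    λ (a , g , (q , e) , xy∈R) → let j , eʳ = ∈⇒!! xy∈R in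
    ih v (applied-eventually (formula q [] j) g (λ N → ∃[ p ] Γ N !! p ≡ just (y , φ)) λ b bit a≼b →
           _ , ⊖-effect (length b) (nodeAt b) q [] j bit (AtPos-persistent (λ ()) a≼b e) (⊑-!! (≼-⊑ a≼b) eʳ))
         satφ

  truth-lemma : ∀ φ → Refuted φ
  truth-lemma (atom p)  = refute-atom p
  truth-lemma (natom p) = λ w appears sat → sat appears
  truth-lemma (φ ∨′ ψ)  = refute-∨ (truth-lemma φ) (truth-lemma ψ)
  truth-lemma (φ ∧′ ψ)  = refute-∧ (truth-lemma φ) (truth-lemma ψ)
  truth-lemma (□ φ)     = refute-□ (truth-lemma φ)
  truth-lemma (◇ φ)     = refute-◇ (truth-lemma φ)
  truth-lemma ([ i ] φ) = refute-[] (truth-lemma φ)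
  truth-lemma (⟨ i ⟩ φ) = refute-⟨⟩ (truth-lemma φ)
  truth-lemma (⊗ i φ)   = refute-⊗ (truth-lemma φ)
  truth-lemma (⊖ i φ)   = refute-⊖ (truth-lemma φ)

  -- Labels outside the root sequent are sent to an arbitrary world.
  I : Label → World
  I x with x <? B
  ... | yes x<B = x , pure ([] , root-open , inj₁ x<B)
  ... | no _    = 0 , pure ([] , root-open , inj₁ (s≤s z≤n))

  ⌊I⌋ : ∀ {x} → x < B → ⌊ I x ⌋ ≡ x
  ⌊I⌋ {x} x<B with x <? B
  ... | yes _   = refl
  ... | no x≮B = ⊥-elim (x≮B x<B)

  root-label : ∀ {x r} → r ∈ R₀ → OccR x r → ⌊ I x ⌋ ≡ x
  root-label r∈R₀ o = ⌊I⌋ (root-R< (lose r∈R₀ o))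

  root-atom-holds : ∀ {r} → r ∈ R₀ → HoldsR M I r
  root-atom-holds {R□a x y} r∈R₀
    rewrite root-label {x} r∈R₀ (inj₁ refl) | root-label {y} r∈R₀ (inj₂ refl)
    = pure ([] , root-open , □atom⇒Walk◇ {a = []} r∈R₀)
  root-atom-holds {R[]a i x y} r∈R₀
    rewrite root-label {x} r∈R₀ (inj₁ refl) | root-label {y} r∈R₀ (inj₂ refl)
    = pure ([] , root-open , []atom⇒Walk[] {a = []} r∈R₀)
  root-atom-holds {R⊗a i x y} r∈R₀
    rewrite root-label {x} r∈R₀ (inj₁ refl) | root-label {y} r∈R₀ (inj₂ refl)
    = pure ([] , root-open , r∈R₀)

  root-refuted : ¬ Sat M I (R₀ ⊢ Γ₀)
  root-refuted sat with find (sat (All.tabulate root-atom-holds))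
  ... | (x , φ) , f∈Γ₀ , holds =
    truth-lemma φ (I x) (pure ([] , root-open , appears)) holds
    where
    appears : At (⌊ I x ⌋ , φ) []
    appears rewrite ⌊I⌋ (root-Γ< (lose f∈Γ₀ refl)) = ∈⇒!! f∈Γ₀

lemmaA2 : (n : ℕ) → 1 ≤ n → (X : Ext) → (Λ : Sequent n) →
          ¬ ¬ (Derivable X Λ ⊎
               Σ (Model n X) λ M → Σ (Label → Model.W M) λ I → ¬ Sat M I Λ)
lemmaA2 (suc m) _ X (R₀ ⊢ Γ₀) no-answer = no-answer (inj₂ (M , I , root-refuted))
  where open Countermodel m X R₀ Γ₀ (no-answer ∘ inj₁)
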